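{- For every positive integer $n$, \[ \binom{2n}{n}_q \equiv [2]_{q^{n^2}} - \frac{n^2-1}{12}(q^n-1)^2 \pmod{\Phi_n(q)^3}, \] where $[2]_{q^{n^2}} = 1+q^{n^2}$.
   Context: $[n]_q = 1+q+\cdots+q^{n-1}$, $[n]_q! = [n]_q\cdots[1]_q$, $\binom{n}{k}_q = \frac{[n]_q!}{[k]_q![n-k]_q!}$. $\Phi_n(q)$ is the $n$th cyclotomic polynomial. A congruence $f\equiv g\pmod{\varphi(q)}$ means $f-g=h\varphi$ for some $h\in\mathbb{Q}[q^{\pm1}]$. -}

module Defs where

open import Data.Nat as ℕ using (ℕ; zero; suc)
open import Data.Nat.Divisibility using (_∣?_)
open import Data.Integer as ℤ using (ℤ)
open import Data.Rational as ℚ using (ℚ; 0ℚ; 1ℚ)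
open import Data.List using (List; []; _∷_; map; filter; foldr; upTo)
open import Data.Product using (Σ; ∃; _×_)
open import Relation.Binary.PropositionalEquality using (_≡_)

-- Univariate polynomials over ℚ in the variable q,
-- as coefficient lists, constant term first.
Poly : Set
Poly = List ℚ

coeff : Poly → ℕ → ℚ
coeff []      _       = 0ℚ
coeff (a ∷ p) zero    = a
coeff (a ∷ p) (suc i) = coeff p i

infix 4 _≈ₚ_
_≈ₚ_ : Poly → Poly → Set
p ≈ₚ r = ∀ i → coeff p i ≡ coeff r i

infixl 6 _+ₚ_ _-ₚ_
infixl 7 _*ₚ_ _·ₚ_
infixr 8 _^ₚ_

_+ₚ_ : Poly → Poly → Poly
[]      +ₚ r       = r
(a ∷ p) +ₚ []      = a ∷ p
(a ∷ p) +ₚ (b ∷ r) = (a ℚ.+ b) ∷ (p +ₚ r)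

_·ₚ_ : ℚ → Poly → Poly
c ·ₚ p = map (c ℚ.*_) p

-ₚ_ : Poly → Poly
-ₚ p = map ℚ.-_ p

_-ₚ_ : Poly → Poly → Poly
p -ₚ r = p +ₚ (-ₚ r)

_*ₚ_ : Poly → Poly → Poly
[]      *ₚ r = []
(a ∷ p) *ₚ r = (a ·ₚ r) +ₚ (0ℚ ∷ (p *ₚ r))

oneₚ : Poly
oneₚ = 1ℚ ∷ []

X : Poly
X = 0ℚ ∷ 1ℚ ∷ []

_^ₚ_ : Poly → ℕ → Poly
p ^ₚ zero  = oneₚ
p ^ₚ suc k = p *ₚ (p ^ₚ k)

prodₚ : List Poly → Poly
prodₚ = foldr _*ₚ_ oneₚ

qint : ℕ → Poly
qint m = foldr _+ₚ_ [] (map (X ^ₚ_) (upTo m))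

qfact : ℕ → Poly
qfact zero    = oneₚ
qfact (suc m) = qint (suc m) *ₚ qfact m

divisors : ℕ → List ℕ
divisors m = filter (_∣? m) (map suc (upTo m))

-- Φ is the family of cyclotomic polynomials:
-- for every m ≥ 1,  ∏_{d ∣ m} Φ_d(q) = q^m − 1.
-- (This determines every Φ_m uniquely, ℚ[q] being a domain.)
IsCyclotomic : (ℕ → Poly) → Set
IsCyclotomic Φ = ∀ m → 1 ℕ.≤ m → prodₚ (map Φ (divisors m)) ≈ₚ (X ^ₚ m) -ₚ oneₚ

-- f ≡ g (mod φ) in ℚ[q^{±1}]: f − g = h φ for a Laurent polynomial h.
-- Writing h = q^{−k} h' with h' ∈ ℚ[q]: q^k (f − g) = h' φ.
infix 4 _≡_[modₚ_]
_≡_[modₚ_] : Poly → Poly → Poly → Set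
f ≡ g [modₚ φ ] = Σ ℕ λ k → Σ Poly λ h → (X ^ₚ k) *ₚ (f -ₚ g) ≈ₚ h *ₚ φ

module Submission where

-- For n ≥ 2 write B = binom(2n,n)_q, N = [n]_q, y = qⁿ − 1 = (q − 1) N.
-- (1) ℚ[q] (coefficient lists up to coefficientwise equality) is a commutative
--     ring, so identities are discharged by the ring solver; congruences are
--     proved by exhibiting L − R as an explicit combination of known congruences.
-- (2) From the cyclotomic factorisation and Bézout for (j, n), each q^j − 1 with
--     0 < j < n is invertible modulo Φ_n; a Bézout identity lifts to the cube, so
--     it is invertible modulo Φ_n³.  Hence 1/[j]_q makes sense mod Φ_n³, and
--     N³ ≡ 0 because (q − 1) N = Φ_n · P_n.
-- (3) Expanding B = (1 + qⁿ) ∏_{j<n} [n+j]/[j] to second order in N gives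
--     2B ≡ (1 + qⁿ)(2 + 2N s + N²(s² − p)) with power sums s, p of q^j/[j].
-- (4) Modulo Φ_n (more precisely after multiplying by N²) every q^j is an n-th
--     root of unity, so Σ_j q^j/[j]² is evaluated through the closed forms of
--     Σ k w^k and Σ k² w^k; this yields N² Σ_j q^j/[j]² ≡ −(n²−1)/12 · y².
-- (5) Substituting, together with (1 + y)ⁿ ≡ 1 + n y + n(n−1)/2 · y², gives the
--     claim.  The case n = 1 is a direct computation.

open import Defs
open import Data.Nat using (ℕ; _*_; _≤_)
open import Data.Integer using (+_)
open import Data.Rational using (ℚ; _/_)

open import Level using (0ℓ)
open import Data.Nat as ℕ using (zero; suc; _+_; _∸_; _<_; s≤s; z≤n; _≤?_; _<?_; NonZero)
import Data.Nat.Properties as ℕP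
open import Data.Nat.Divisibility using (_∣_; _∣?_; ∣-trans; ∣-refl; ∣⇒≤; 0∣⇒≡0)
open import Data.Nat.GCD using (module Bézout; module GCD)
open import Data.Nat.Induction using (<-rec)
import Data.Integer as ℤ
import Data.Integer.Properties as ℤP
import Data.Integer.Solver
open import Data.Rational as ℚ using (0ℚ; 1ℚ)
import Data.Rational.Properties as ℚP
open import Algebra.Properties.Group ℚP.+-0-group using (x∙y⁻¹≈ε⇒x≈y)
import Data.Rational.Solver
open import Data.Rational.Unnormalised as ℚᵘ using (mkℚᵘ; *≡*)
import Data.Rational.Unnormalised.Properties as ℚᵘP
open import Data.List using (List; []; _∷_; _∷ʳ_; _++_; map; filter; foldr; upTo)
import Data.List.Properties as ListP
open import Data.Maybe using (Maybe; just; nothing)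
open import Data.Product using (Σ; _×_; _,_; proj₁; proj₂)
open import Data.Empty using (⊥-elim)
open import Relation.Nullary using (yes; no; ¬_)
open import Relation.Binary.PropositionalEquality using (_≡_; refl; sym; trans; cong; cong₂; subst; module ≡-Reasoning)
import Relation.Binary.Reasoning.Setoid as SetoidReasoning
open import Algebra.Structures using (IsCommutativeRing)
open import Algebra.Bundles using (CommutativeRing)
import Algebra.Solver.Ring.AlmostCommutativeRing as ACR
import Algebra.Solver.Ring

-- ℚ[q] is a commutative ring.  Polynomials are compared coefficientwise; the
-- record wrapper makes the relation injective so that its indices are inferable.
module PolynomialRing where

  open Data.Rational.Solver.+-*-Solver
    using () renaming (solve to ℚ-solve; _:=_ to _:=ℚ_; _:+_ to _:+ℚ_)

  infix 4 _≋_
  record _≋_ (p r : Poly) : Set where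
    constructor ⟨_⟩
    field un : p ≈ₚ r
  open _≋_ public

  ≋-refl : ∀ {p} → p ≋ p
  ≋-refl = ⟨ (λ i → refl) ⟩

  ≋-sym : ∀ {p r} → p ≋ r → r ≋ p
  ≋-sym e = ⟨ (λ i → sym (un e i)) ⟩

  ≋-trans : ∀ {p r s} → p ≋ r → r ≋ s → p ≋ s
  ≋-trans e f = ⟨ (λ i → trans (un e i) (un f i)) ⟩

  ≡⇒≋ : ∀ {p r} → p ≡ r → p ≋ r
  ≡⇒≋ refl = ≋-refl

  cst : ℚ → Poly
  cst c = c ∷ []

  cst-* : ∀ a b → cst a *ₚ cst b ≋ cst (a ℚ.* b)
  cst-* a b = ⟨ (λ { zero → ℚP.+-identityʳ (a ℚ.* b) ; (suc i) → refl }) ⟩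

  sh : Poly → Poly
  sh p = 0ℚ ∷ p

  coeff-+ : ∀ p r i → coeff (p +ₚ r) i ≡ coeff p i ℚ.+ coeff r i
  coeff-+ []      r       i       = sym (ℚP.+-identityˡ (coeff r i))
  coeff-+ (a ∷ p) []      zero    = sym (ℚP.+-identityʳ a)
  coeff-+ (a ∷ p) []      (suc i) = sym (ℚP.+-identityʳ (coeff p i))
  coeff-+ (a ∷ p) (b ∷ r) zero    = refl
  coeff-+ (a ∷ p) (b ∷ r) (suc i) = coeff-+ p r i

  coeff-· : ∀ c p i → coeff (c ·ₚ p) i ≡ c ℚ.* coeff p i
  coeff-· c []      i       = sym (ℚP.*-zeroʳ c)
  coeff-· c (a ∷ p) zero    = refl
  coeff-· c (a ∷ p) (suc i) = coeff-· c p i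

  coeff-neg : ∀ p i → coeff (-ₚ p) i ≡ ℚ.- coeff p i
  coeff-neg []      i       = refl
  coeff-neg (a ∷ p) zero    = refl
  coeff-neg (a ∷ p) (suc i) = coeff-neg p i

  +-cong : ∀ {p p' r r'} → p ≋ p' → r ≋ r' → p +ₚ r ≋ p' +ₚ r'
  +-cong {p} {p'} {r} {r'} e f = ⟨ (λ i →
    trans (coeff-+ p r i) (trans (cong₂ ℚ._+_ (un e i) (un f i)) (sym (coeff-+ p' r' i)))) ⟩

  ·-cong : ∀ c {p p'} → p ≋ p' → c ·ₚ p ≋ c ·ₚ p'
  ·-cong c {p} {p'} e = ⟨ (λ i →
    trans (coeff-· c p i) (trans (cong (c ℚ.*_) (un e i)) (sym (coeff-· c p' i)))) ⟩

  ·-congˡ : ∀ {c d} p → c ≡ d → c ·ₚ p ≋ d ·ₚ p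
  ·-congˡ p refl = ≋-refl

  neg-cong : ∀ {p p'} → p ≋ p' → -ₚ p ≋ -ₚ p'
  neg-cong {p} {p'} e = ⟨ (λ i →
    trans (coeff-neg p i) (trans (cong ℚ.-_ (un e i)) (sym (coeff-neg p' i)))) ⟩

  sh-cong : ∀ {p p'} → p ≋ p' → sh p ≋ sh p'
  sh-cong e = ⟨ (λ { zero → refl ; (suc i) → un e i }) ⟩

  +-comm : ∀ p r → p +ₚ r ≋ r +ₚ p
  +-comm p r = ⟨ (λ i →
    trans (coeff-+ p r i) (trans (ℚP.+-comm (coeff p i) (coeff r i)) (sym (coeff-+ r p i)))) ⟩

  +-assoc : ∀ p r s → (p +ₚ r) +ₚ s ≋ p +ₚ (r +ₚ s)
  +-assoc p r s = ⟨ (λ i → begin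
      coeff ((p +ₚ r) +ₚ s) i                 ≡⟨ coeff-+ (p +ₚ r) s i ⟩
      coeff (p +ₚ r) i ℚ.+ coeff s i          ≡⟨ cong (ℚ._+ coeff s i) (coeff-+ p r i) ⟩
      (coeff p i ℚ.+ coeff r i) ℚ.+ coeff s i ≡⟨ ℚP.+-assoc (coeff p i) (coeff r i) (coeff s i) ⟩
      coeff p i ℚ.+ (coeff r i ℚ.+ coeff s i) ≡⟨ cong (coeff p i ℚ.+_) (coeff-+ r s i) ⟨
      coeff p i ℚ.+ coeff (r +ₚ s) i          ≡⟨ coeff-+ p (r +ₚ s) i ⟨
      coeff (p +ₚ (r +ₚ s)) i                 ∎) ⟩
    where open ≡-Reasoning

  +-identityʳ : ∀ p → p +ₚ [] ≋ p
  +-identityʳ []      = ≋-refl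
  +-identityʳ (a ∷ p) = ≋-refl

  +-inverseʳ : ∀ p → p +ₚ (-ₚ p) ≋ []
  +-inverseʳ p = ⟨ (λ i → trans (coeff-+ p (-ₚ p) i)
    (trans (cong (coeff p i ℚ.+_) (coeff-neg p i)) (ℚP.+-inverseʳ (coeff p i)))) ⟩

  +-swap : ∀ a b c d → (a +ₚ b) +ₚ (c +ₚ d) ≋ (a +ₚ c) +ₚ (b +ₚ d)
  +-swap a b c d = ⟨ (λ i →
    trans (coeff-+ (a +ₚ b) _ i) (trans (cong₂ ℚ._+_ (coeff-+ a b i) (coeff-+ c d i))
    (trans (ℚ-solve 4 (λ x y z w → (x :+ℚ y) :+ℚ (z :+ℚ w) :=ℚ (x :+ℚ z) :+ℚ (y :+ℚ w)) refl
                      (coeff a i) (coeff b i) (coeff c i) (coeff d i))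
    (sym (trans (coeff-+ (a +ₚ c) _ i) (cong₂ ℚ._+_ (coeff-+ a c i) (coeff-+ b d i))))))) ⟩

  ·-+ : ∀ c p r → c ·ₚ (p +ₚ r) ≋ c ·ₚ p +ₚ c ·ₚ r
  ·-+ c p r = ⟨ (λ i →
    trans (coeff-· c (p +ₚ r) i) (trans (cong (c ℚ.*_) (coeff-+ p r i))
    (trans (ℚP.*-distribˡ-+ c (coeff p i) (coeff r i))
    (sym (trans (coeff-+ (c ·ₚ p) (c ·ₚ r) i) (cong₂ ℚ._+_ (coeff-· c p i) (coeff-· c r i))))))) ⟩

  +-· : ∀ c d p → (c ℚ.+ d) ·ₚ p ≋ c ·ₚ p +ₚ d ·ₚ p
  +-· c d p = ⟨ (λ i →
    trans (coeff-· (c ℚ.+ d) p i) (trans (ℚP.*-distribʳ-+ (coeff p i) c d)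
    (sym (trans (coeff-+ (c ·ₚ p) (d ·ₚ p) i) (cong₂ ℚ._+_ (coeff-· c p i) (coeff-· d p i)))))) ⟩

  ·-· : ∀ c d p → c ·ₚ (d ·ₚ p) ≋ (c ℚ.* d) ·ₚ p
  ·-· c d p = ⟨ (λ i →
    trans (coeff-· c (d ·ₚ p) i) (trans (cong (c ℚ.*_) (coeff-· d p i))
    (trans (sym (ℚP.*-assoc c d (coeff p i))) (sym (coeff-· (c ℚ.* d) p i))))) ⟩

  0-· : ∀ p → 0ℚ ·ₚ p ≋ []
  0-· p = ⟨ (λ i → trans (coeff-· 0ℚ p i) (ℚP.*-zeroˡ (coeff p i))) ⟩

  1-· : ∀ p → 1ℚ ·ₚ p ≋ p
  1-· p = ⟨ (λ i → trans (coeff-· 1ℚ p i) (ℚP.*-identityˡ (coeff p i))) ⟩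

  ·-sh : ∀ c p → c ·ₚ sh p ≋ sh (c ·ₚ p)
  ·-sh c p = ⟨ (λ { zero → ℚP.*-zeroʳ c ; (suc i) → refl }) ⟩

  sh-+ : ∀ p r → sh (p +ₚ r) ≋ sh p +ₚ sh r
  sh-+ p r = ⟨ (λ { zero → sym (ℚP.+-identityʳ 0ℚ) ; (suc i) → refl }) ⟩

  sh-[] : sh [] ≋ []
  sh-[] = ⟨ (λ { zero → refl ; (suc i) → refl }) ⟩

  -- Multiplication.  Since p *ₚ r recurses on p, the laws are proved by
  -- induction on the left factor; commutativity rests on *-cons.

  *-zeroʳ : ∀ p → p *ₚ [] ≋ []
  *-zeroʳ []      = ≋-refl
  *-zeroʳ (a ∷ p) = ≋-trans (sh-cong (*-zeroʳ p)) sh-[]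

  *-vanishˡ : ∀ p r → p ≋ [] → p *ₚ r ≋ []
  *-vanishˡ []      r e = ≋-refl
  *-vanishˡ (a ∷ p) r e = ≋-trans
    (+-cong {a ·ₚ r} {[]} {sh (p *ₚ r)} {sh []} (≋-trans (·-congˡ r (un e zero)) (0-· r))
            (sh-cong (*-vanishˡ p r ⟨ (λ i → un e (suc i)) ⟩)))
    sh-[]

  *-congˡ : ∀ {p p'} r → p ≋ p' → p *ₚ r ≋ p' *ₚ r
  *-congˡ {[]}    {p'}     r e = ≋-sym (*-vanishˡ p' r (≋-sym e))
  *-congˡ {a ∷ p} {[]}     r e = *-vanishˡ (a ∷ p) r e
  *-congˡ {a ∷ p} {a' ∷ p'} r e =
    +-cong (·-congˡ r (un e zero)) (sh-cong (*-congˡ {p} {p'} r ⟨ (λ i → un e (suc i)) ⟩))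

  *-congʳ : ∀ p {r r'} → r ≋ r' → p *ₚ r ≋ p *ₚ r'
  *-congʳ []      e = ≋-refl
  *-congʳ (a ∷ p) e = +-cong (·-cong a e) (sh-cong (*-congʳ p e))

  *-cong : ∀ {p p' r r'} → p ≋ p' → r ≋ r' → p *ₚ r ≋ p' *ₚ r'
  *-cong {p} {p'} {r} e f = ≋-trans (*-congˡ r e) (*-congʳ p' f)

  *-distribʳ : ∀ p p' r → (p +ₚ p') *ₚ r ≋ p *ₚ r +ₚ p' *ₚ r
  *-distribʳ []      p'       r = ≋-refl
  *-distribʳ (a ∷ p) []       r = ≋-sym (+-identityʳ _)
  *-distribʳ (a ∷ p) (b ∷ p') r = ≋-trans
    (+-cong (+-· a b r) (≋-trans (sh-cong (*-distribʳ p p' r)) (sh-+ (p *ₚ r) (p' *ₚ r))))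
    (+-swap (a ·ₚ r) (b ·ₚ r) (sh (p *ₚ r)) (sh (p' *ₚ r)))

  *-distribˡ : ∀ p r r' → p *ₚ (r +ₚ r') ≋ p *ₚ r +ₚ p *ₚ r'
  *-distribˡ []      r r' = ≋-refl
  *-distribˡ (a ∷ p) r r' = ≋-trans
    (+-cong (·-+ a r r') (≋-trans (sh-cong (*-distribˡ p r r')) (sh-+ (p *ₚ r) (p *ₚ r'))))
    (+-swap (a ·ₚ r) (a ·ₚ r') (sh (p *ₚ r)) (sh (p *ₚ r')))

  ·-*ˡ : ∀ c p r → (c ·ₚ p) *ₚ r ≋ c ·ₚ (p *ₚ r)
  ·-*ˡ c []      r = ≋-refl
  ·-*ˡ c (a ∷ p) r = ≋-trans
    (+-cong (≋-sym (·-· c a r)) (≋-trans (sh-cong (·-*ˡ c p r)) (≋-sym (·-sh c (p *ₚ r)))))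
    (≋-sym (·-+ c (a ·ₚ r) (sh (p *ₚ r))))

  sh-*ˡ : ∀ p r → sh p *ₚ r ≋ sh (p *ₚ r)
  sh-*ˡ p r = +-cong (0-· r) ≋-refl

  *-assoc : ∀ p r s → (p *ₚ r) *ₚ s ≋ p *ₚ (r *ₚ s)
  *-assoc []      r s = ≋-refl
  *-assoc (a ∷ p) r s = ≋-trans (*-distribʳ (a ·ₚ r) (sh (p *ₚ r)) s)
    (+-cong (·-*ˡ a r s) (≋-trans (sh-*ˡ (p *ₚ r) s) (sh-cong (*-assoc p r s))))

  *-cons : ∀ p b r → p *ₚ (b ∷ r) ≋ b ·ₚ p +ₚ sh (p *ₚ r)
  *-cons []      b r = ≋-sym sh-[]
  *-cons (a ∷ p) b r =
    ≋-trans (+-cong {a ·ₚ (b ∷ r)} ≋-refl (sh-cong (*-cons p b r))) ⟨ coefficients ⟩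
    where
    coefficients : a ·ₚ (b ∷ r) +ₚ sh (b ·ₚ p +ₚ sh (p *ₚ r))
                 ≈ₚ b ·ₚ (a ∷ p) +ₚ sh (a ·ₚ r +ₚ sh (p *ₚ r))
    coefficients zero =
      trans (ℚP.+-identityʳ (a ℚ.* b)) (trans (ℚP.*-comm a b) (sym (ℚP.+-identityʳ (b ℚ.* a))))
    coefficients (suc i) =
      trans (coeff-+ (a ·ₚ r) _ i) (trans (cong (coeff (a ·ₚ r) i ℚ.+_) (coeff-+ (b ·ₚ p) _ i))
      (trans (ℚ-solve 3 (λ x y z → x :+ℚ (y :+ℚ z) :=ℚ y :+ℚ (x :+ℚ z)) refl
                        (coeff (a ·ₚ r) i) (coeff (b ·ₚ p) i) (coeff (sh (p *ₚ r)) i))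
      (sym (trans (coeff-+ (b ·ₚ p) _ i) (cong (coeff (b ·ₚ p) i ℚ.+_) (coeff-+ (a ·ₚ r) _ i))))))

  *-comm : ∀ p r → p *ₚ r ≋ r *ₚ p
  *-comm []      r = ≋-sym (*-zeroʳ r)
  *-comm (a ∷ p) r =
    ≋-trans (+-cong {a ·ₚ r} ≋-refl (sh-cong (*-comm p r))) (≋-sym (*-cons r a p))

  *-identityˡ : ∀ p → oneₚ *ₚ p ≋ p
  *-identityˡ p = ≋-trans (+-cong (1-· p) sh-[]) (+-identityʳ p)

  *-identityʳ : ∀ p → p *ₚ oneₚ ≋ p
  *-identityʳ p = ≋-trans (*-comm p oneₚ) (*-identityˡ p)

  isCommutativeRing : IsCommutativeRing _≋_ _+ₚ_ _*ₚ_ -ₚ_ [] oneₚ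
  isCommutativeRing = record
    { isRing = record
      { +-isAbelianGroup = record
        { isGroup = record
          { isMonoid = record
            { isSemigroup = record
              { isMagma = record
                { isEquivalence = record { refl = ≋-refl ; sym = ≋-sym ; trans = ≋-trans }
                ; ∙-cong = +-cong }
              ; assoc = +-assoc }
            ; identity = (λ p → ≋-refl) , +-identityʳ }
          ; inverse = (λ p → ≋-trans (+-comm (-ₚ p) p) (+-inverseʳ p)) , +-inverseʳ
          ; ⁻¹-cong = neg-cong }
        ; comm = +-comm }
      ; *-cong = *-cong
      ; *-assoc = *-assoc
      ; *-identity = *-identityˡ , *-identityʳ
      ; distrib = *-distribˡ , (λ r p p' → *-distribʳ p p' r) }
    ; *-comm = *-comm }

  module Solver where
    ring : CommutativeRing 0ℓ 0ℓ
    ring = record { isCommutativeRing = isCommutativeRing }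

    constants : ACR._-Raw-AlmostCommutative⟶_
                  (CommutativeRing.rawRing ℚP.+-*-commutativeRing) (ACR.fromCommutativeRing ring)
    constants = record
      { ⟦_⟧    = cst
      ; +-homo = λ a b → ≋-refl
      ; *-homo = λ a b → ≋-sym (cst-* a b)
      ; -‿homo = λ a → ≋-refl
      ; 0-homo = ⟨ (λ { zero → refl ; (suc i) → refl }) ⟩
      ; 1-homo = ≋-refl }

    cst-≟ : ∀ a b → Maybe (cst a ≋ cst b)
    cst-≟ a b with a ℚ.≟ b
    ... | yes refl = just ≋-refl
    ... | no _     = nothing

    open Algebra.Solver.Ring _ _ constants cst-≟ public
      using (solve; Polynomial; _:=_; _:+_; _:*_; _:-_; :-_; con)

  module ≋-Reasoning = SetoidReasoning (CommutativeRing.setoid Solver.ring)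

open PolynomialRing
open PolynomialRing.Solver using (solve; _:=_; _:+_; _:*_; _:-_; :-_; con)

-- Natural numbers as rational constants.  `nat` is defined by recursion, so
-- that nat (suc m) = 1 + nat m holds definitionally and the ring solver can
-- see it.
module Constants where

  nat : ℕ → ℚ
  nat zero    = 0ℚ
  nat (suc m) = 1ℚ ℚ.+ nat m

  natₚ : ℕ → Poly
  natₚ m = cst (nat m)

  cst-*ₚ : ∀ c p → cst c *ₚ p ≋ c ·ₚ p
  cst-*ₚ c p = ≋-trans (+-cong (≋-refl {c ·ₚ p}) sh-[]) (+-identityʳ (c ·ₚ p))

  nat-nonNegative : ∀ m → ℚ.NonNegative (nat m)
  nat-nonNegative zero    = _
  nat-nonNegative (suc m) = ℚP.nonNeg+nonNeg⇒nonNeg 1ℚ {{_}} (nat m) {{nat-nonNegative m}}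

  -- positive integers are invertible in ℚ; this is where characteristic 0 enters
  nat-invertible : ∀ m → Σ ℚ (λ r → cst r *ₚ natₚ (suc m) ≋ oneₚ)
  nat-invertible m = ℚ.1/ nat (suc m) ,
    ≋-trans (cst-* (ℚ.1/ nat (suc m)) (nat (suc m))) (≡⇒≋ (cong cst (ℚP.*-inverseˡ (nat (suc m)))))
    where
    instance
      nonZero : ℚ.NonZero (nat (suc m))
      nonZero = ℚP.pos⇒nonZero (nat (suc m))
                  {{ℚP.pos+nonNeg⇒pos 1ℚ {{_}} (nat m) {{nat-nonNegative m}}}}

open Constants

-- Finite sums and products indexed by 1 ≤ j ≤ k (sumF, prodF) or 0 ≤ k < m (sumK).
module FiniteSums where

  sumF : (ℕ → Poly) → ℕ → Poly
  sumF f zero    = cst 0ℚ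
  sumF f (suc k) = sumF f k +ₚ f (suc k)

  prodF : (ℕ → Poly) → ℕ → Poly
  prodF f zero    = oneₚ
  prodF f (suc k) = prodF f k *ₚ f (suc k)

  sumK : (ℕ → Poly) → ℕ → Poly
  sumK f zero    = cst 0ℚ
  sumK f (suc m) = sumK f m +ₚ f m

  Range : ℕ → ℕ → Set
  Range k j = 1 ≤ j × j ≤ k

  range-suc : ∀ {k j} → Range k j → Range (suc k) j
  range-suc (a , b) = a , ℕP.m≤n⇒m≤1+n b

  range-top : ∀ k → Range (suc k) (suc k)
  range-top k = s≤s z≤n , ℕP.≤-refl

  sumF-+ : ∀ f g k → sumF (λ j → f j +ₚ g j) k ≋ sumF f k +ₚ sumF g k
  sumF-+ f g zero    = solve 0 (con 0ℚ := con 0ℚ :+ con 0ℚ) ≋-refl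
  sumF-+ f g (suc k) =
    ≋-trans (+-cong (sumF-+ f g k) ≋-refl) (+-swap (sumF f k) (sumF g k) (f (suc k)) (g (suc k)))

  sumF-scale : ∀ c f k → sumF (λ j → c *ₚ f j) k ≋ c *ₚ sumF f k
  sumF-scale c f zero    = solve 1 (λ c → con 0ℚ := c :* con 0ℚ) ≋-refl c
  sumF-scale c f (suc k) =
    ≋-trans (+-cong (sumF-scale c f k) ≋-refl) (≋-sym (*-distribˡ c (sumF f k) (f (suc k))))

  sumF-const : ∀ c k → sumF (λ _ → c) k ≋ natₚ k *ₚ c
  sumF-const c zero    = solve 1 (λ c → con 0ℚ := con 0ℚ :* c) ≋-refl c
  sumF-const c (suc k) = ≋-trans (+-cong (sumF-const c k) ≋-refl)
    (solve 2 (λ a c → a :* c :+ c := (con 1ℚ :+ a) :* c) ≋-refl (natₚ k) c)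

  sumF-cong : ∀ {f g} k → (∀ j → Range k j → f j ≋ g j) → sumF f k ≋ sumF g k
  sumF-cong zero    h = ≋-refl
  sumF-cong (suc k) h = +-cong (sumF-cong k (λ j r → h j (range-suc r))) (h (suc k) (range-top k))

  sumK-scale : ∀ c f m → sumK (λ k → c *ₚ f k) m ≋ c *ₚ sumK f m
  sumK-scale c f zero    = solve 1 (λ c → con 0ℚ := c :* con 0ℚ) ≋-refl c
  sumK-scale c f (suc m) =
    ≋-trans (+-cong (sumK-scale c f m) ≋-refl) (≋-sym (*-distribˡ c (sumK f m) (f m)))

  sumK-cong : ∀ {f g} m → (∀ k → k < m → f k ≋ g k) → sumK f m ≋ sumK g m
  sumK-cong zero    h = ≋-refl
  sumK-cong (suc m) h = +-cong (sumK-cong m (λ k r → h k (ℕP.m<n⇒m<1+n r))) (h m ℕP.≤-refl)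

  sum-swap : ∀ (f : ℕ → ℕ → Poly) K m →
             sumF (λ j → sumK (f j) m) K ≋ sumK (λ k → sumF (λ j → f j k) K) m
  sum-swap f K zero    =
    ≋-trans (sumF-const (cst 0ℚ) K) (solve 1 (λ a → a :* con 0ℚ := con 0ℚ) ≋-refl (natₚ K))
  sum-swap f K (suc m) =
    ≋-trans (sumF-+ (λ j → sumK (f j) m) (λ j → f j m) K) (+-cong (sum-swap f K m) ≋-refl)

  sumF-shift : ∀ f k → sumF f (suc k) ≋ f 1 +ₚ sumF (λ j → f (suc j)) k
  sumF-shift f zero    = solve 1 (λ a → con 0ℚ :+ a := a :+ con 0ℚ) ≋-refl (f 1)
  sumF-shift f (suc k) = ≋-trans (+-cong (sumF-shift f k) ≋-refl) (+-assoc (f 1) _ _)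

  sumF-reverse : ∀ f k → sumF f k ≋ sumF (λ j → f (suc k ∸ j)) k
  sumF-reverse f zero    = ≋-refl
  sumF-reverse f (suc k) =
    ≋-trans (sumF-shift f k) (≋-trans (+-cong (≋-refl {f 1}) (sumF-reverse (λ j → f (suc j)) k))
    (≋-trans (+-comm (f 1) _)
    (+-cong (sumF-cong k (λ j r → ≡⇒≋ (cong f (sym (ℕP.+-∸-assoc 1 (ℕP.≤-trans (proj₂ r) (ℕP.n≤1+n k)))))))
            (≡⇒≋ (cong f (sym (ℕP.m+n∸n≡m 1 k)))))))

  prodF-* : ∀ f g k → prodF (λ j → f j *ₚ g j) k ≋ prodF f k *ₚ prodF g k
  prodF-* f g zero    = solve 0 (con 1ℚ := con 1ℚ :* con 1ℚ) ≋-refl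
  prodF-* f g (suc k) = ≋-trans (*-congˡ (f (suc k) *ₚ g (suc k)) (prodF-* f g k))
    (solve 4 (λ a b c d → a :* b :* (c :* d) := a :* c :* (b :* d)) ≋-refl
             (prodF f k) (prodF g k) (f (suc k)) (g (suc k)))

  prodF-one : ∀ k → prodF (λ _ → oneₚ) k ≋ oneₚ
  prodF-one zero    = ≋-refl
  prodF-one (suc k) = ≋-trans (*-identityʳ _) (prodF-one k)

open FiniteSums

-- The weight is needed once below, with W = N², to compute
-- "modulo Φ_n" while working inside the modulus Φ_n³.
record Congruent (W m a b : Poly) : Set where
  constructor multiple
  field
    quotient : Poly
    divides  : W *ₚ (a -ₚ b) ≋ quotient *ₚ m
open Congruent public

-- The workhorse is
-- by-combination: to show L ≡ R it suffices to write L − R, as a polynomial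
-- identity, as a combination Σ cᵢ (aᵢ − bᵢ) of already established
-- congruences aᵢ ≡ bᵢ (each summand `Vanishes`).
module Modulo (W m : Poly) where

  infix 4 _∼_
  _∼_ : Poly → Poly → Set
  a ∼ b = Congruent W m a b

  ∼-refl : ∀ {a} → a ∼ a
  ∼-refl {a} = multiple (cst 0ℚ) (solve 3 (λ W m a → W :* (a :- a) := con 0ℚ :* m) ≋-refl W m a)

  ∼-sym : ∀ {a b} → a ∼ b → b ∼ a
  ∼-sym {a} {b} (multiple h e) = multiple (-ₚ h)
    (≋-trans (solve 3 (λ W a b → W :* (b :- a) := :- (W :* (a :- b))) ≋-refl W a b)
    (≋-trans (neg-cong e) (solve 2 (λ h m → :- (h :* m) := (:- h) :* m) ≋-refl h m)))

  ∼-trans : ∀ {a b c} → a ∼ b → b ∼ c → a ∼ c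
  ∼-trans {a} {b} {c} (multiple h e) (multiple h' e') = multiple (h +ₚ h')
    (≋-trans (solve 4 (λ W a b c → W :* (a :- c) := W :* (a :- b) :+ W :* (b :- c)) ≋-refl W a b c)
    (≋-trans (+-cong e e') (solve 3 (λ h h' m → h :* m :+ h' :* m := (h :+ h') :* m) ≋-refl h h' m)))

  ≋⇒∼ : ∀ {a b} → a ≋ b → a ∼ b
  ≋⇒∼ {a} {b} e = multiple (cst 0ℚ) (≋-trans (*-congʳ W (+-cong e ≋-refl))
    (solve 3 (λ W m b → W :* (b :- b) := con 0ℚ :* m) ≋-refl W m b))

  +-cong∼ : ∀ {p p' r r'} → p ∼ p' → r ∼ r' → (p +ₚ r) ∼ (p' +ₚ r')
  +-cong∼ {p} {p'} {r} {r'} (multiple h e) (multiple h' e') = multiple (h +ₚ h')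
    (≋-trans (solve 5 (λ W p p' r r' → W :* ((p :+ r) :- (p' :+ r')) := W :* (p :- p') :+ W :* (r :- r'))
                      ≋-refl W p p' r r')
    (≋-trans (+-cong e e') (solve 3 (λ h h' m → h :* m :+ h' :* m := (h :+ h') :* m) ≋-refl h h' m)))

  *-cong∼ : ∀ {p p' r r'} → p ∼ p' → r ∼ r' → (p *ₚ r) ∼ (p' *ₚ r')
  *-cong∼ {p} {p'} {r} {r'} (multiple h e) (multiple h' e') = multiple (h *ₚ r +ₚ h' *ₚ p')
    (≋-trans (solve 5 (λ W p p' r r' → W :* (p :* r :- p' :* r') := (W :* (p :- p')) :* r :+ (W :* (r :- r')) :* p')
                      ≋-refl W p p' r r')
    (≋-trans (+-cong (*-cong e (≋-refl {r})) (*-cong e' (≋-refl {p'})))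
    (solve 5 (λ h h' m r p' → (h :* m) :* r :+ (h' :* m) :* p' := (h :* r :+ h' :* p') :* m)
             ≋-refl h h' m r p')))

  *-congˡ∼ : ∀ c {a b} → a ∼ b → (c *ₚ a) ∼ (c *ₚ b)
  *-congˡ∼ c e = *-cong∼ (∼-refl {c}) e

  Vanishes : Poly → Set
  Vanishes t = t ∼ cst 0ℚ

  vanishes-scaled : ∀ {a b} → a ∼ b → ∀ c → Vanishes (c *ₚ (a -ₚ b))
  vanishes-scaled {a} {b} (multiple h e) c = multiple (c *ₚ h)
    (≋-trans (solve 4 (λ W c a b → W :* (c :* (a :- b) :- con 0ℚ) := c :* (W :* (a :- b))) ≋-refl W c a b)
    (≋-trans (*-congʳ c e) (≋-sym (*-assoc c h m))))

  vanishes-+ : ∀ {s t} → Vanishes s → Vanishes t → Vanishes (s +ₚ t)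
  vanishes-+ {s} {t} (multiple h e) (multiple h' e') = multiple (h +ₚ h')
    (≋-trans (solve 3 (λ W s t → W :* ((s :+ t) :- con 0ℚ) := W :* (s :- con 0ℚ) :+ W :* (t :- con 0ℚ))
                      ≋-refl W s t)
    (≋-trans (+-cong e e') (≋-sym (*-distribʳ h h' m))))

  by-combination : ∀ {L R t} → Vanishes t → L -ₚ R ≋ t → L ∼ R
  by-combination {L} {R} {t} z e =
    ∼-trans (≋⇒∼ (solve 2 (λ L R → L := (L :- R) :+ R) ≋-refl L R))
    (∼-trans (+-cong∼ (∼-trans (≋⇒∼ e) z) (∼-refl {R}))
    (≋⇒∼ (solve 1 (λ R → con 0ℚ :+ R := R) ≋-refl R)))

  cancel-invertible : ∀ {a r b c} → (r *ₚ a) ∼ oneₚ → (a *ₚ b) ∼ (a *ₚ c) → b ∼ c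
  cancel-invertible {a} {r} {b} {c} ra∼1 ab∼ac = by-combination
    (vanishes-+ (vanishes-scaled ab∼ac r) (vanishes-scaled ra∼1 (-ₚ (b -ₚ c))))
    (solve 4 (λ a r b c → b :- c := r :* (a :* b :- a :* c) :+ (:- (b :- c)) :* (r :* a :- con 1ℚ)) ≋-refl a r b c)

  sumF-cong∼ : ∀ {f g} k → (∀ j → Range k j → f j ∼ g j) → sumF f k ∼ sumF g k
  sumF-cong∼ zero    h = ∼-refl
  sumF-cong∼ (suc k) h = +-cong∼ (sumF-cong∼ k (λ j r → h j (range-suc r))) (h (suc k) (range-top k))

  prodF-cong∼ : ∀ {f g} k → (∀ j → Range k j → f j ∼ g j) → prodF f k ∼ prodF g k
  prodF-cong∼ zero    h = ∼-refl
  prodF-cong∼ (suc k) h = *-cong∼ (prodF-cong∼ k (λ j r → h j (range-suc r))) (h (suc k) (range-top k))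

  sumK-cong∼ : ∀ {f g} m → (∀ k → k < m → f k ∼ g k) → sumK f m ∼ sumK g m
  sumK-cong∼ zero    h = ∼-refl
  sumK-cong∼ (suc m) h = +-cong∼ (sumK-cong∼ m (λ k r → h k (ℕP.m<n⇒m<1+n r))) (h m ℕP.≤-refl)

  ^-cong∼ : ∀ {a b} k → a ∼ b → (a ^ₚ k) ∼ (b ^ₚ k)
  ^-cong∼ zero    e = ∼-refl
  ^-cong∼ (suc k) e = *-cong∼ e (^-cong∼ k e)

unweight : ∀ {V m a b} → Congruent V m a b → Congruent oneₚ m (V *ₚ a) (V *ₚ b)
unweight {V} {m} {a} {b} (multiple h e) =
  multiple h (≋-trans (solve 3 (λ V a b → con 1ℚ :* (V :* a :- V :* b) := V :* (a :- b)) ≋-refl V a b) e)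

module QIntegers where

  ^-+ : ∀ p a b → p ^ₚ (a + b) ≋ p ^ₚ a *ₚ p ^ₚ b
  ^-+ p zero    b = ≋-sym (*-identityˡ _)
  ^-+ p (suc a) b = ≋-trans (*-congʳ p (^-+ p a b)) (≋-sym (*-assoc p (p ^ₚ a) (p ^ₚ b)))

  ^-* : ∀ p a b → p ^ₚ (a * b) ≋ (p ^ₚ a) ^ₚ b
  ^-* p a zero    = ≡⇒≋ (cong (p ^ₚ_) (ℕP.*-zeroʳ a))
  ^-* p a (suc b) = ≋-trans (≡⇒≋ (cong (p ^ₚ_) (ℕP.*-suc a b)))
                    (≋-trans (^-+ p a (a * b)) (*-congʳ (p ^ₚ a) (^-* p a b)))

  ^-cong : ∀ {p r} k → p ≋ r → p ^ₚ k ≋ r ^ₚ k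
  ^-cong zero    e = ≋-refl
  ^-cong (suc k) e = *-cong e (^-cong k e)

  one-^ : ∀ k → oneₚ ^ₚ k ≋ oneₚ
  one-^ zero    = ≋-refl
  one-^ (suc k) = ≋-trans (*-identityˡ _) (one-^ k)

  X^-swap : ∀ j m → (X ^ₚ j) ^ₚ m ≋ (X ^ₚ m) ^ₚ j
  X^-swap j m = ≋-trans (≋-sym (^-* X j m))
                (≋-trans (≡⇒≋ (cong (X ^ₚ_) (ℕP.*-comm j m))) (^-* X m j))

  geom : Poly → ℕ → Poly
  geom w zero    = cst 0ℚ
  geom w (suc m) = geom w m +ₚ w ^ₚ m

  geom-telescope : ∀ w m → (w -ₚ oneₚ) *ₚ geom w m ≋ w ^ₚ m -ₚ oneₚ
  geom-telescope w zero    = solve 1 (λ w → (w :- con 1ℚ) :* con 0ℚ := con 1ℚ :- con 1ℚ) ≋-refl w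
  geom-telescope w (suc m) =
    ≋-trans (*-distribˡ (w -ₚ oneₚ) (geom w m) (w ^ₚ m)) (≋-trans (+-cong (geom-telescope w m) ≋-refl)
    (solve 2 (λ w a → (a :- con 1ℚ) :+ (w :- con 1ℚ) :* a := w :* a :- con 1ℚ) ≋-refl w (w ^ₚ m)))

  geom-+ : ∀ w a b → geom w (a + b) ≋ geom w a +ₚ w ^ₚ a *ₚ geom w b
  geom-+ w a zero    = ≋-trans (≡⇒≋ (cong (geom w) (ℕP.+-identityʳ a)))
    (solve 2 (λ g c → g := g :+ c :* con 0ℚ) ≋-refl (geom w a) (w ^ₚ a))
  geom-+ w a (suc b) = ≋-trans (≡⇒≋ (cong (geom w) (ℕP.+-suc a b)))
    (≋-trans (+-cong (geom-+ w a b) (^-+ w a b))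
    (solve 4 (λ g c h d → g :+ c :* h :+ c :* d := g :+ c :* (h :+ d)) ≋-refl
             (geom w a) (w ^ₚ a) (geom w b) (w ^ₚ b)))

  geom-sumF : ∀ w K → geom w (suc K) ≋ oneₚ +ₚ sumF (λ j → w ^ₚ j) K
  geom-sumF w zero    = solve 0 (con 0ℚ :+ con 1ℚ := con 1ℚ :+ con 0ℚ) ≋-refl
  geom-sumF w (suc K) = ≋-trans (+-cong (geom-sumF w K) ≋-refl) (+-assoc oneₚ (sumF (λ j → w ^ₚ j) K) (w ^ₚ suc K))

  geom-≡-length : ∀ w m → Σ Poly (λ K → geom w m -ₚ natₚ m ≋ (w -ₚ oneₚ) *ₚ K)
  geom-≡-length w zero    = cst 0ℚ , solve 1 (λ w → con 0ℚ :- con 0ℚ := (w :- con 1ℚ) :* con 0ℚ) ≋-refl w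
  geom-≡-length w (suc m) with geom-≡-length w m
  ... | K , e = K +ₚ geom w m ,
    ≋-trans (solve 4 (λ g a k t → (g :+ a) :- (con 1ℚ :+ k) := (g :- k) :+ (a :- con 1ℚ)) ≋-refl
                     (geom w m) (w ^ₚ m) (natₚ m) (cst 0ℚ))
    (≋-trans (+-cong e (≋-sym (geom-telescope w m))) (≋-sym (*-distribˡ (w -ₚ oneₚ) K (geom w m))))

  u : ℕ → Poly
  u j = X ^ₚ j -ₚ oneₚ

  u-multiple : ∀ j a → u (j * a) ≋ u j *ₚ geom (X ^ₚ j) a
  u-multiple j a = ≋-trans (+-cong (^-* X j a) ≋-refl) (≋-sym (geom-telescope (X ^ₚ j) a))

  foldr-+-∷ʳ : ∀ xs y → foldr _+ₚ_ [] (xs ∷ʳ y) ≋ foldr _+ₚ_ [] xs +ₚ y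
  foldr-+-∷ʳ []       y = +-identityʳ y
  foldr-+-∷ʳ (x ∷ xs) y = ≋-trans (+-cong (≋-refl {x}) (foldr-+-∷ʳ xs y)) (≋-sym (+-assoc x _ y))

  qint-geom : ∀ m → qint m ≋ geom X m
  qint-geom zero    = ⟨ (λ { zero → refl ; (suc i) → refl }) ⟩
  qint-geom (suc m) =
    ≋-trans (≡⇒≋ (cong (λ l → foldr _+ₚ_ [] (map (X ^ₚ_) l)) (sym (ListP.upTo-∷ʳ m))))
    (≋-trans (≡⇒≋ (cong (foldr _+ₚ_ []) (ListP.map-++ (X ^ₚ_) (upTo m) (m ∷ []))))
    (≋-trans (foldr-+-∷ʳ (map (X ^ₚ_) (upTo m)) (X ^ₚ m)) (+-cong (qint-geom m) ≋-refl)))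

  qint-+ : ∀ a b → qint (a + b) ≋ qint a +ₚ X ^ₚ a *ₚ qint b
  qint-+ a b = ≋-trans (qint-geom (a + b)) (≋-trans (geom-+ X a b)
    (+-cong (≋-sym (qint-geom a)) (*-congʳ (X ^ₚ a) (≋-sym (qint-geom b)))))

  u1-qint : ∀ m → u 1 *ₚ qint m ≋ u m
  u1-qint m = ≋-trans (*-congˡ (qint m) (+-cong (*-identityʳ X) (≋-refl { -ₚ oneₚ})))
              (≋-trans (*-congʳ (X -ₚ oneₚ) (qint-geom m)) (geom-telescope X m))

  X^-qint : ∀ j → X ^ₚ j ≋ oneₚ +ₚ u 1 *ₚ qint j
  X^-qint j = ≋-trans (solve 1 (λ x → x := con 1ℚ :+ (x :- con 1ℚ)) ≋-refl (X ^ₚ j))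
                      (+-cong (≋-refl {oneₚ}) (≋-sym (u1-qint j)))

  qfact-prodF : ∀ m → qfact m ≋ prodF qint m
  qfact-prodF zero    = ≋-refl
  qfact-prodF (suc m) = ≋-trans (*-congʳ (qint (suc m)) (qfact-prodF m)) (*-comm (qint (suc m)) (prodF qint m))

  qfact-+ : ∀ n k → qfact (n + k) ≋ prodF (λ j → qint (n + j)) k *ₚ qfact n
  qfact-+ n zero    = ≋-trans (≡⇒≋ (cong qfact (ℕP.+-identityʳ n))) (≋-sym (*-identityˡ (qfact n)))
  qfact-+ n (suc k) = ≋-trans (≡⇒≋ (cong qfact (ℕP.+-suc n k)))
    (≋-trans (*-congʳ (qint (suc (n + k))) (qfact-+ n k))
    (≋-trans (≡⇒≋ (cong (λ z → qint z *ₚ (prodF (λ j → qint (n + j)) k *ₚ qfact n)) (sym (ℕP.+-suc n k))))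
    (solve 3 (λ a b c → a :* (b :* c) := b :* a :* c) ≋-refl
             (qint (n + suc k)) (prodF (λ j → qint (n + j)) k) (qfact n))))

open QIntegers

module Divisibility where

  X-sh : ∀ p → X *ₚ p ≋ sh p
  X-sh p = +-cong (0-· p) (sh-cong (*-identityˡ p))

  shⁿ : ℕ → Poly → Poly
  shⁿ zero    p = p
  shⁿ (suc g) p = sh (shⁿ g p)

  X^-sh : ∀ g p → X ^ₚ g *ₚ p ≋ shⁿ g p
  X^-sh zero    p = *-identityˡ p
  X^-sh (suc g) p = ≋-trans (*-assoc X (X ^ₚ g) p) (≋-trans (*-congʳ X (X^-sh g p)) (X-sh (shⁿ g p)))

  shⁿ-high : ∀ g p i → coeff (shⁿ g p) (g + i) ≡ coeff p i
  shⁿ-high zero    p i = refl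
  shⁿ-high (suc g) p i = shⁿ-high g p i

  shⁿ-low : ∀ g p i → i < g → coeff (shⁿ g p) i ≡ 0ℚ
  shⁿ-low (suc g) p zero    _          = refl
  shⁿ-low (suc g) p (suc i) (s≤s i<g) = shⁿ-low g p i i<g

  -- q^g − 1 (g ≥ 1) is not a zero divisor: from q^g E = E, comparing
  -- coefficients gives E_i = E_{i−g} for i ≥ g and E_i = 0 for i < g.
  u-cancel : ∀ g → 1 ≤ g → ∀ E → u g *ₚ E ≋ [] → E ≋ []
  u-cancel g g≥1 E uE≋0 = ⟨ (λ i → <-rec (λ i → coeff E i ≡ 0ℚ) step i) ⟩
    where
    shifted-equal : ∀ i → coeff (shⁿ g E) i ≡ coeff E i
    shifted-equal i = x∙y⁻¹≈ε⇒x≈y _ _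
      (trans (cong (ℚ._+ (ℚ.- coeff E i)) (sym (un (X^-sh g E) i)))
      (trans (cong (coeff (X ^ₚ g *ₚ E) i ℚ.+_) (sym (coeff-neg E i)))
      (trans (sym (coeff-+ (X ^ₚ g *ₚ E) (-ₚ E) i))
             (un (≋-trans (solve 2 (λ a e → a :* e :- e := (a :- con 1ℚ) :* e) ≋-refl (X ^ₚ g) E) uE≋0) i))))
    step : ∀ i → (∀ {j} → j < i → coeff E j ≡ 0ℚ) → coeff E i ≡ 0ℚ
    step i rec with i ℕ.<? g
    ... | yes i<g = trans (sym (shifted-equal i)) (shⁿ-low g E i i<g)
    ... | no  i≮g = trans (sym (shifted-equal i))
                    (trans (cong (coeff (shⁿ g E)) (sym g+k≡i)) (trans (shⁿ-high g E k) (rec k<i)))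
      where
      k = i ∸ g
      g+k≡i : g + k ≡ i
      g+k≡i = ℕP.m+[n∸m]≡n (ℕP.≮⇒≥ i≮g)
      k<i : k < i
      k<i = ℕP.<-≤-trans (ℕP.n<1+n k) (subst (λ z → suc k ≤ z) g+k≡i (ℕP.+-monoˡ-≤ k g≥1))

  -- A Bézout relation α a + β φ = 1 lifts to the cube: cubing it shows that
  -- a is invertible modulo φ³.
  bezout-cube : ∀ a φ α β → α *ₚ a +ₚ β *ₚ φ ≋ oneₚ →
                Σ Poly λ w → Congruent oneₚ (φ ^ₚ 3) (a *ₚ w) oneₚ
  bezout-cube a φ α β bezout =
    w , multiple (-ₚ (β *ₚ β *ₚ β)) (≋-trans
      (*-congʳ oneₚ (+-cong (≋-refl {a *ₚ w}) (neg-cong (≋-sym (≋-trans (^-cong 3 bezout) (one-^ 3))))))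
      (solve 4 (λ a φ α β →
          con 1ℚ :* (a :* (α :* (α :* α :* a :* a :+ con (nat 3) :* α :* β :* a :* φ
                                  :+ con (nat 3) :* β :* β :* φ :* φ))
                     :- (α :* a :+ β :* φ) :* ((α :* a :+ β :* φ) :* ((α :* a :+ β :* φ) :* con 1ℚ)))
          := (:- (β :* β :* β)) :* (φ :* (φ :* (φ :* con 1ℚ))))
        ≋-refl a φ α β))
    where
    w = α *ₚ (α *ₚ α *ₚ a *ₚ a +ₚ natₚ 3 *ₚ α *ₚ β *ₚ a *ₚ φ +ₚ natₚ 3 *ₚ β *ₚ β *ₚ φ *ₚ φ)

open Divisibility

module DivisorProducts (Φ : ℕ → Poly) where

  prodₚ-++ : ∀ xs ys → prodₚ (xs ++ ys) ≋ prodₚ xs *ₚ prodₚ ys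
  prodₚ-++ []       ys = ≋-sym (*-identityˡ _)
  prodₚ-++ (x ∷ xs) ys = ≋-trans (*-congʳ x (prodₚ-++ xs ys)) (≋-sym (*-assoc x (prodₚ xs) (prodₚ ys)))

  upTo₁ : ℕ → List ℕ
  upTo₁ k = map suc (upTo k)

  upTo₁-suc : ∀ k → upTo₁ (suc k) ≡ upTo₁ k ++ (suc k ∷ [])
  upTo₁-suc k = trans (cong (map suc) (sym (ListP.upTo-∷ʳ k))) (ListP.map-++ suc (upTo k) (k ∷ []))

  divProd : ℕ → ℕ → Poly
  divProd m k = prodₚ (map Φ (filter (_∣? m) (upTo₁ k)))

  divProd-step : ∀ m k → divProd m (suc k) ≋ divProd m k *ₚ prodₚ (map Φ (filter (_∣? m) (suc k ∷ [])))
  divProd-step m k =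
    ≋-trans (≡⇒≋ (cong (λ l → prodₚ (map Φ (filter (_∣? m) l))) (upTo₁-suc k)))
    (≋-trans (≡⇒≋ (cong (λ l → prodₚ (map Φ l)) (ListP.filter-++ (_∣? m) (upTo₁ k) (suc k ∷ []))))
    (≋-trans (≡⇒≋ (cong prodₚ (ListP.map-++ Φ (filter (_∣? m) (upTo₁ k)) (filter (_∣? m) (suc k ∷ [])))))
             (prodₚ-++ (map Φ (filter (_∣? m) (upTo₁ k))) (map Φ (filter (_∣? m) (suc k ∷ []))))))

  divProd-divisor : ∀ m k → suc k ∣ m → divProd m (suc k) ≋ divProd m k *ₚ Φ (suc k)
  divProd-divisor m k d = ≋-trans (divProd-step m k) (*-congʳ (divProd m k)
    (≋-trans (≡⇒≋ (cong (λ l → prodₚ (map Φ l)) (ListP.filter-accept (_∣? m) d))) (*-identityʳ (Φ (suc k)))))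

  divProd-nondivisor : ∀ m k → ¬ (suc k ∣ m) → divProd m (suc k) ≋ divProd m k
  divProd-nondivisor m k d = ≋-trans (divProd-step m k)
    (≋-trans (*-congʳ (divProd m k) (≡⇒≋ (cong (λ l → prodₚ (map Φ l)) (ListP.filter-reject (_∣? m) d))))
             (*-identityʳ (divProd m k)))

  -- For a proper divisor g of n, the product over the divisors of n splits
  -- into the product over the divisors of g and the complementary factors,
  -- among which is Φ_n itself.
  module ProperDivisor (n g : ℕ) (g∣n : g ∣ n) (g≥1 : 1 ≤ g) (g<n : g < n) where

    instance
      g≢0 : NonZero g
      g≢0 = ℕ.≢-nonZero (λ e → ℕP.<⇒≢ g≥1 (sym e))

    complement : ℕ → Poly
    complement zero = oneₚ
    complement (suc k) with suc k ∣? n | suc k ∣? g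
    ... | yes _ | no _ = complement k *ₚ Φ (suc k)
    ... | _     | _    = complement k

    split : ∀ k → divProd n k ≋ divProd g k *ₚ complement k
    split zero = ≋-sym (*-identityʳ oneₚ)
    split (suc k) with suc k ∣? n | suc k ∣? g
    ... | yes ∣n | no ∤g = ≋-trans (divProd-divisor n k ∣n) (≋-trans (*-congˡ (Φ (suc k)) (split k))
          (≋-trans (*-assoc (divProd g k) (complement k) (Φ (suc k)))
                   (≋-sym (*-cong (divProd-nondivisor g k ∤g) ≋-refl))))
    ... | yes ∣n | yes ∣g = ≋-trans (divProd-divisor n k ∣n) (≋-trans (*-congˡ (Φ (suc k)) (split k))
          (≋-trans (solve 3 (λ a b c → a :* b :* c := a :* c :* b) ≋-refl (divProd g k) (complement k) (Φ (suc k)))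
                   (*-congˡ (complement k) (≋-sym (divProd-divisor g k ∣g)))))
    ... | no ∤n  | yes ∣g = ⊥-elim (∤n (∣-trans ∣g g∣n))
    ... | no ∤n  | no ∤g = ≋-trans (divProd-nondivisor n k ∤n)
          (≋-trans (split k) (*-congˡ (complement k) (≋-sym (divProd-nondivisor g k ∤g))))

    -- no divisor of g exceeds g
    divProd-stable : ∀ t → divProd g (g + t) ≋ divProd g g
    divProd-stable zero    = ≡⇒≋ (cong (divProd g) (ℕP.+-identityʳ g))
    divProd-stable (suc t) = ≋-trans (≡⇒≋ (cong (divProd g) (ℕP.+-suc g t)))
      (≋-trans (divProd-nondivisor g (g + t) (λ d → ℕP.<⇒≱ (s≤s (ℕP.m≤m+n g t)) (∣⇒≤ d)))
               (divProd-stable t))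

    complement-last : ∀ m → suc m ≡ n → complement n ≋ complement m *ₚ Φ n
    complement-last m refl with suc m ∣? suc m | suc m ∣? g
    ... | yes _  | no _  = ≋-refl
    ... | no ∤n  | _     = ⊥-elim (∤n ∣-refl)
    ... | yes _  | yes ∣g = ⊥-elim (ℕP.<⇒≱ g<n (∣⇒≤ ∣g))

divisor-positive : ∀ {g n} → 1 ≤ n → g ∣ n → 1 ≤ g
divisor-positive {zero}  n≥1 ∣0 = ⊥-elim (ℕP.<⇒≢ n≥1 (sym (0∣⇒≡0 ∣0)))
divisor-positive {suc g} _   _  = s≤s z≤n

InIdeal : Poly → Poly → Poly → Set
InIdeal a b p = Σ Poly λ s → Σ Poly λ t → p ≋ s *ₚ a +ₚ t *ₚ b

ideal-trans : ∀ {a b c p} → InIdeal c b p → InIdeal a b c → InIdeal a b p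
ideal-trans {a} {b} {c} (s , t , e) (s' , t' , e') = s *ₚ s' , s *ₚ t' +ₚ t , ≋-trans e
  (≋-trans (+-cong (*-congʳ s e') (≋-refl {t *ₚ b}))
  (solve 6 (λ s t s' t' a b → s :* (s' :* a :+ t' :* b) :+ t :* b := s :* s' :* a :+ (s :* t' :+ t) :* b)
           ≋-refl s t s' t' a b))

ideal-scale : ∀ {a b p q} r → r *ₚ p ≋ q → InIdeal a b p → InIdeal a b q
ideal-scale {a} {b} {p} r rp≋q (s , t , e) = r *ₚ s , r *ₚ t , ≋-trans (≋-sym rp≋q)
  (≋-trans (*-congʳ r e) (solve 5 (λ r s t a b → r :* (s :* a :+ t :* b) := r :* s :* a :+ r :* t :* b)
                                  ≋-refl r s t a b))

-- If g + c k = e l then q^g − 1 is a combination of q^l − 1 and q^k − 1: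
-- q^{el} − 1 = q^g (q^{ck} − 1) + (q^g − 1).
u-combination : ∀ g c k e l → g + c * k ≡ e * l →
                u g ≋ geom (X ^ₚ l) e *ₚ u l +ₚ (-ₚ (X ^ₚ g *ₚ geom (X ^ₚ k) c)) *ₚ u k
u-combination g c k e l eq = begin
  u g
    ≈⟨ solve 3 (λ xg xkc xle → xg :- con 1ℚ := ((xle :- con 1ℚ) :- xg :* (xkc :- con 1ℚ)) :- (xle :- xg :* xkc))
             ≋-refl (X ^ₚ g) (X ^ₚ (k * c)) (X ^ₚ (l * e)) ⟩
  (u (l * e) -ₚ X ^ₚ g *ₚ u (k * c)) -ₚ (X ^ₚ (l * e) -ₚ X ^ₚ g *ₚ X ^ₚ (k * c))
    ≈⟨ +-cong (≋-refl {u (l * e) -ₚ X ^ₚ g *ₚ u (k * c)}) (neg-cong exponents) ⟩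
  (u (l * e) -ₚ X ^ₚ g *ₚ u (k * c)) -ₚ []
    ≈⟨ +-identityʳ _ ⟩
  u (l * e) -ₚ X ^ₚ g *ₚ u (k * c)
    ≈⟨ +-cong (u-multiple l e) (neg-cong (*-congʳ (X ^ₚ g) (u-multiple k c))) ⟩
  u l *ₚ geom (X ^ₚ l) e -ₚ X ^ₚ g *ₚ (u k *ₚ geom (X ^ₚ k) c)
    ≈⟨ solve 5 (λ ul gl xg uk gk → ul :* gl :- xg :* (uk :* gk) := gl :* ul :+ (:- (xg :* gk)) :* uk)
             ≋-refl (u l) (geom (X ^ₚ l) e) (X ^ₚ g) (u k) (geom (X ^ₚ k) c) ⟩
  geom (X ^ₚ l) e *ₚ u l +ₚ (-ₚ (X ^ₚ g *ₚ geom (X ^ₚ k) c)) *ₚ u k ∎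
  where
  open ≋-Reasoning
  exponents : X ^ₚ (l * e) -ₚ X ^ₚ g *ₚ X ^ₚ (k * c) ≋ []
  exponents = ≋-trans (+-cong (≋-trans (≡⇒≋ (cong (X ^ₚ_) (sym (trans (cong (ℕ._+_ g) (ℕP.*-comm k c))
                                                                   (trans eq (ℕP.*-comm e l))))))
                                        (^-+ X g (k * c))) ≋-refl)
                      (+-inverseʳ (X ^ₚ g *ₚ X ^ₚ (k * c)))

module CoprimeToCyclotomic (Φ : ℕ → Poly) (cyclotomic : IsCyclotomic Φ) (n : ℕ) (n≥1 : 1 ≤ n) where
  open DivisorProducts Φ

  divProd-u : ∀ m → 1 ≤ m → divProd m m ≋ u m
  divProd-u m m≥1 = ⟨ cyclotomic m m≥1 ⟩

  n-1 : ℕ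
  n-1 = n ∸ 1

  n-1+1≡n : suc n-1 ≡ n
  n-1+1≡n = ℕP.m+[n∸m]≡n n≥1

  -- the cofactor of Φ_n in qⁿ − 1
  P : Poly
  P = divProd n n-1

  Φ-divides-u : Φ n *ₚ P ≋ u n
  Φ-divides-u = ≋-trans (*-comm (Φ n) P) (≋-trans (≋-sym (last n-1+1≡n)) (divProd-u n n≥1))
    where
    last : ∀ {m} → suc n-1 ≡ m → divProd m m ≋ divProd m n-1 *ₚ Φ m
    last refl = divProd-divisor (suc n-1) n-1 ∣-refl

  -- For a proper divisor g of n = d g, Φ_n divides [d]_{q^g}: both
  -- u_g [d]_{q^g} and u_g Φ_n (complement) equal qⁿ − 1, and u_g cancels.
  -- As [d]_{q^g} ≡ d (mod q^g − 1), the constant d lies in the ideal (u_g, Φ_n).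
  proper-divisor-ideal : ∀ g → g ∣ n → 1 ≤ g → g < n →
                         Σ ℕ λ d-1 → InIdeal (u g) (Φ n) (natₚ (suc d-1))
  proper-divisor-ideal g g∣n g≥1 g<n with _∣_.quotient g∣n | _∣_.equality g∣n
  ... | zero  | n≡0 = ⊥-elim (ℕP.<⇒≢ n≥1 (sym n≡0))
  ... | suc d-1 | n≡dg = d-1 , -ₚ K , complement n-1 , (begin
    natₚ d
      ≈⟨ solve 4 (λ k gg pe kk → k := pe :- (gg :- k) :+ (gg :- pe)) ≋-refl
                 (natₚ d) (geom w d) (Φ n *ₚ complement n-1) K ⟩
    Φ n *ₚ complement n-1 -ₚ (geom w d -ₚ natₚ d) +ₚ (geom w d -ₚ Φ n *ₚ complement n-1)
      ≈⟨ +-cong (+-cong (≋-refl {Φ n *ₚ complement n-1}) (neg-cong (proj₂ (geom-≡-length w d))))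
                (u-cancel g g≥1 _ cancelled) ⟩
    Φ n *ₚ complement n-1 -ₚ u g *ₚ K +ₚ []
      ≈⟨ +-identityʳ _ ⟩
    Φ n *ₚ complement n-1 -ₚ u g *ₚ K
      ≈⟨ solve 4 (λ φ c ug k → φ :* c :- ug :* k := (:- k) :* ug :+ c :* φ) ≋-refl
                 (Φ n) (complement n-1) (u g) K ⟩
    (-ₚ K) *ₚ u g +ₚ complement n-1 *ₚ Φ n ∎)
    where
    open ProperDivisor n g g∣n g≥1 g<n
    open ≋-Reasoning
    d = suc d-1
    w = X ^ₚ g
    K = proj₁ (geom-≡-length w d)
    via-geom : u n ≋ u g *ₚ geom w d
    via-geom = ≋-trans (≡⇒≋ (cong (λ z → X ^ₚ z -ₚ oneₚ) (trans n≡dg (ℕP.*-comm d g)))) (u-multiple g d)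
    via-Φ : u n ≋ u g *ₚ (Φ n *ₚ complement n-1)
    via-Φ = ≋-trans (≋-sym (divProd-u n n≥1)) (≋-trans (split n)
      (≋-trans (*-cong (≋-trans (≋-trans (≡⇒≋ (cong (divProd g) (sym (ℕP.m+[n∸m]≡n (ℕP.<⇒≤ g<n)))))
                                         (divProd-stable (n ∸ g)))
                                (divProd-u g g≥1))
                       (complement-last n-1 n-1+1≡n))
               (*-congʳ (u g) (*-comm (complement n-1) (Φ n)))))
    cancelled : u g *ₚ (geom w d -ₚ Φ n *ₚ complement n-1) ≋ []
    cancelled = ≋-trans (solve 3 (λ a b c → a :* (b :- c) := a :* b :- a :* c) ≋-refl
                               (u g) (geom w d) (Φ n *ₚ complement n-1))
                (≋-trans (+-cong (≋-sym via-geom) (neg-cong (≋-sym via-Φ))) (+-inverseʳ (u n)))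

  -- with g = gcd(j, n), Bézout's identity puts u_g in the ideal (u_j, u_n) ⊆ (u_j, Φ_n)
  gcd-ideal : ∀ {g j} → Bézout.Identity g j n → InIdeal (u j) (Φ n) (u g)
  gcd-ideal {g} {j} (Bézout.+- a b eq) =
    geom (X ^ₚ j) a , -ₚ (X ^ₚ g *ₚ geom (X ^ₚ n) b) *ₚ P ,
    ≋-trans (u-combination g b n a j eq)
            (+-cong (≋-refl {geom (X ^ₚ j) a *ₚ u j})
                    (≋-trans (*-congʳ (-ₚ (X ^ₚ g *ₚ geom (X ^ₚ n) b)) (≋-sym Φ-divides-u))
                             (solve 3 (λ c φ p → c :* (φ :* p) := c :* p :* φ) ≋-refl (-ₚ (X ^ₚ g *ₚ geom (X ^ₚ n) b)) (Φ n) P)))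
  gcd-ideal {g} {j} (Bézout.-+ a b eq) =
    -ₚ (X ^ₚ g *ₚ geom (X ^ₚ j) a) , geom (X ^ₚ n) b *ₚ P ,
    ≋-trans (u-combination g a j b n eq)
    (≋-trans (+-comm (geom (X ^ₚ n) b *ₚ u n) (-ₚ (X ^ₚ g *ₚ geom (X ^ₚ j) a) *ₚ u j))
            (+-cong (≋-refl { -ₚ (X ^ₚ g *ₚ geom (X ^ₚ j) a) *ₚ u j})
                    (≋-trans (*-congʳ (geom (X ^ₚ n) b) (≋-sym Φ-divides-u))
                             (solve 3 (λ c φ p → c :* (φ :* p) := c :* p :* φ) ≋-refl (geom (X ^ₚ n) b) (Φ n) P))))

  -- gcd(j, n) is a proper divisor g of n, so u_g and hence the integer n/g lie
  -- in (u_j, Φ_n); dividing by n/g gives a Bézout relation, which lifts to Φ_n³.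
  u-invertible : ∀ j → 1 ≤ j → j < n → Σ Poly λ w → Congruent oneₚ (Φ n ^ₚ 3) (u j *ₚ w) oneₚ
  u-invertible j j≥1 j<n = from-gcd (Bézout.lemma j n)
    where
    from-gcd : Bézout.Lemma j n → Σ Poly λ w → Congruent oneₚ (Φ n ^ₚ 3) (u j *ₚ w) oneₚ
    from-gcd (Bézout.result g gcd identity) = bezout-cube (u j) (Φ n) (proj₁ one∈ideal) (proj₁ (proj₂ one∈ideal))
                                                          (≋-sym (proj₂ (proj₂ one∈ideal)))
      where
      g∣n = GCD.GCD.gcd∣n gcd
      g≥1 = divisor-positive n≥1 g∣n
      g<n = ℕP.≤-<-trans (∣⇒≤ {{ℕ.≢-nonZero (λ e → ℕP.<⇒≢ j≥1 (sym e))}} (GCD.GCD.gcd∣m gcd)) j<n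
      quotient∈ideal = proper-divisor-ideal g g∣n g≥1 g<n
      d-1 = proj₁ quotient∈ideal
      one∈ideal : InIdeal (u j) (Φ n) oneₚ
      one∈ideal = ideal-scale (cst (proj₁ (nat-invertible d-1))) (proj₂ (nat-invertible d-1))
                              (ideal-trans (proj₂ quotient∈ideal) (gcd-ideal identity))

-- Closed forms for Σ_{k<m} k w^k and Σ_{k<m} k² w^k, valid for any w; they
-- are used when w = q^j is an n-th root of unity modulo Φ_n.
module PowerSums where

  powerSum₁ : Poly → ℕ → Poly
  powerSum₁ w m = sumK (λ k → natₚ k *ₚ w ^ₚ k) m

  powerSum₂ : Poly → ℕ → Poly
  powerSum₂ w m = sumK (λ k → natₚ k *ₚ natₚ k *ₚ w ^ₚ k) m

  powerSum₁-closed : ∀ w m → (w -ₚ oneₚ) *ₚ powerSum₁ w m +ₚ geom w m +ₚ w ^ₚ m ≋ natₚ m *ₚ w ^ₚ m +ₚ oneₚ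
  powerSum₁-closed w zero    =
    solve 1 (λ w → (w :- con 1ℚ) :* con 0ℚ :+ con 0ℚ :+ con 1ℚ := con 0ℚ :* con 1ℚ :+ con 1ℚ) ≋-refl w
  powerSum₁-closed w (suc m) =
    ≋-trans (solve 5 (λ w y g p k → (w :- con 1ℚ) :* (y :+ k :* p) :+ (g :+ p) :+ w :* p
                := ((w :- con 1ℚ) :* y :+ g :+ p) :+ ((w :- con 1ℚ) :* k :* p :+ w :* p))
                ≋-refl w (powerSum₁ w m) (geom w m) (w ^ₚ m) (natₚ m))
    (≋-trans (+-cong (powerSum₁-closed w m) ≋-refl)
    (solve 3 (λ w p k → (k :* p :+ con 1ℚ) :+ ((w :- con 1ℚ) :* k :* p :+ w :* p)
                      := (con 1ℚ :+ k) :* (w :* p) :+ con 1ℚ)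
             ≋-refl w (w ^ₚ m) (natₚ m)))

  powerSum₂-closed : ∀ w m → (w -ₚ oneₚ) *ₚ powerSum₂ w m +ₚ natₚ 2 *ₚ powerSum₁ w m +ₚ oneₚ
                           ≋ (natₚ m -ₚ oneₚ) *ₚ (natₚ m -ₚ oneₚ) *ₚ w ^ₚ m +ₚ geom w m
  powerSum₂-closed w zero    =
    solve 1 (λ w → (w :- con 1ℚ) :* con 0ℚ :+ con (nat 2) :* con 0ℚ :+ con 1ℚ
                   := (con 0ℚ :- con 1ℚ) :* (con 0ℚ :- con 1ℚ) :* con 1ℚ :+ con 0ℚ) ≋-refl w
  powerSum₂-closed w (suc m) =
    ≋-trans (solve 5 (λ w y2 y1 p k → (w :- con 1ℚ) :* (y2 :+ k :* k :* p) :+ con (nat 2) :* (y1 :+ k :* p) :+ con 1ℚ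
                := ((w :- con 1ℚ) :* y2 :+ con (nat 2) :* y1 :+ con 1ℚ)
                   :+ ((w :- con 1ℚ) :* k :* k :* p :+ con (nat 2) :* k :* p))
                ≋-refl w (powerSum₂ w m) (powerSum₁ w m) (w ^ₚ m) (natₚ m))
    (≋-trans (+-cong (powerSum₂-closed w m) ≋-refl)
    (solve 4 (λ w p k g → ((k :- con 1ℚ) :* (k :- con 1ℚ) :* p :+ g) :+ ((w :- con 1ℚ) :* k :* k :* p :+ con (nat 2) :* k :* p)
                := ((con 1ℚ :+ k) :- con 1ℚ) :* ((con 1ℚ :+ k) :- con 1ℚ) :* (w :* p) :+ (g :+ p))
             ≋-refl w (w ^ₚ m) (natₚ m) (geom w m)))

  powerSum-combination : ∀ w c m → w *ₚ (c *ₚ powerSum₁ w m -ₚ powerSum₂ w m)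
                                   ≋ sumK (λ k → (c *ₚ natₚ k -ₚ natₚ k *ₚ natₚ k) *ₚ w ^ₚ suc k) m
  powerSum-combination w c zero    = solve 2 (λ w c → w :* (c :* con 0ℚ :- con 0ℚ) := con 0ℚ) ≋-refl w c
  powerSum-combination w c (suc m) =
    ≋-trans (solve 6 (λ w c y1 y2 k p → w :* (c :* (y1 :+ k :* p) :- (y2 :+ k :* k :* p))
                      := w :* (c :* y1 :- y2) :+ (c :* k :- k :* k) :* (w :* p))
                      ≋-refl w c (powerSum₁ w m) (powerSum₂ w m) (natₚ m) (w ^ₚ m))
            (+-cong (powerSum-combination w c m) ≋-refl)

  quadratic-sum : ∀ c m → natₚ 6 *ₚ sumK (λ k → c *ₚ natₚ k -ₚ natₚ k *ₚ natₚ k) m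
                         ≋ natₚ 3 *ₚ c *ₚ natₚ m *ₚ (natₚ m -ₚ oneₚ)
                           -ₚ (natₚ m -ₚ oneₚ) *ₚ natₚ m *ₚ (natₚ 2 *ₚ natₚ m -ₚ oneₚ)
  quadratic-sum c zero    =
    solve 1 (λ c → con (nat 6) :* con 0ℚ
                   := con (nat 3) :* c :* con 0ℚ :* (con 0ℚ :- con 1ℚ)
                      :- (con 0ℚ :- con 1ℚ) :* con 0ℚ :* (con (nat 2) :* con 0ℚ :- con 1ℚ)) ≋-refl c
  quadratic-sum c (suc m) =
    ≋-trans (*-distribˡ (natₚ 6) (sumK (λ k → c *ₚ natₚ k -ₚ natₚ k *ₚ natₚ k) m) (c *ₚ natₚ m -ₚ natₚ m *ₚ natₚ m))
    (≋-trans (+-cong (quadratic-sum c m) ≋-refl)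
    (solve 2 (λ c k → con (nat 3) :* c :* k :* (k :- con 1ℚ) :- (k :- con 1ℚ) :* k :* (con (nat 2) :* k :- con 1ℚ)
                      :+ con (nat 6) :* (c :* k :- k :* k)
                   := con (nat 3) :* c :* (con 1ℚ :+ k) :* ((con 1ℚ :+ k) :- con 1ℚ)
                      :- ((con 1ℚ :+ k) :- con 1ℚ) :* (con 1ℚ :+ k) :* (con (nat 2) :* (con 1ℚ :+ k) :- con 1ℚ))
             ≋-refl c (natₚ m)))

open PowerSums

module TwelfthConstant where
  open Data.Integer.Solver.+-*-Solver using () renaming
    (solve to ℤ-solve; _:=_ to _:=ℤ_; _:+_ to _:+ℤ_; _:*_ to _:*ℤ_; _:-_ to _:-ℤ_; :-_ to :-ℤ_; con to conℤ)

  nat-toℚᵘ : ∀ m → ℚ.toℚᵘ (nat m) ℚᵘ.≃ mkℚᵘ (+ m) 0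
  nat-toℚᵘ zero    = *≡* refl
  nat-toℚᵘ (suc m) = ℚᵘP.≃-trans (ℚP.toℚᵘ-homo-+ 1ℚ (nat m))
    (ℚᵘP.≃-trans (ℚᵘP.+-cong {ℚ.toℚᵘ 1ℚ} {ℚ.toℚᵘ 1ℚ} ℚᵘP.≃-refl (nat-toℚᵘ m)) (*≡* cross))
    where
    cross : (+ 1 ℤ.* + 1 ℤ.+ + m ℤ.* + 1) ℤ.* + 1 ≡ + suc m ℤ.* + 1
    cross = trans (ℤ-solve 1 (λ a → (conℤ (+ 1) :*ℤ conℤ (+ 1) :+ℤ a :*ℤ conℤ (+ 1)) :*ℤ conℤ (+ 1)
                                   :=ℤ (conℤ (+ 1) :+ℤ a) :*ℤ conℤ (+ 1)) refl (+ m))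
                  (cong (ℤ._* + 1) (sym (ℤP.pos-+ 1 m)))

  twelfth : ∀ n → ((+ (n * n) ℤ.- + 1) / 12) ℚ.* nat 12 ≡ nat n ℚ.* nat n ℚ.- 1ℚ
  twelfth n = ℚP.toℚᵘ-injective (ℚᵘP.≃-trans (ℚP.toℚᵘ-homo-* c (nat 12))
    (ℚᵘP.≃-trans (ℚᵘP.*-cong (ℚP.toℚᵘ-fromℚᵘ (mkℚᵘ z 11)) (nat-toℚᵘ 12))
    (ℚᵘP.≃-trans (*≡* cross) (ℚᵘP.≃-sym (ℚᵘP.≃-trans (ℚP.toℚᵘ-homo-+ (nat n ℚ.* nat n) (ℚ.- 1ℚ))
       (ℚᵘP.+-cong (ℚᵘP.≃-trans (ℚP.toℚᵘ-homo-* (nat n) (nat n)) (ℚᵘP.*-cong (nat-toℚᵘ n) (nat-toℚᵘ n)))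
                   (ℚP.toℚᵘ-homo‿- 1ℚ)))))))
    where
    z = + (n * n) ℤ.- + 1
    c = z / 12
    cross : (z ℤ.* + 12) ℤ.* + 1 ≡ ((+ n ℤ.* + n) ℤ.* + 1 ℤ.+ (ℤ.- + 1) ℤ.* + 1) ℤ.* + 12
    cross = trans (cong (λ w → ((w ℤ.- + 1) ℤ.* + 12) ℤ.* + 1) (ℤP.pos-* n n))
      (ℤ-solve 1 (λ a → ((a :*ℤ a :-ℤ conℤ (+ 1)) :*ℤ conℤ (+ 12)) :*ℤ conℤ (+ 1)
                        :=ℤ (a :*ℤ a :*ℤ conℤ (+ 1) :+ℤ (:-ℤ conℤ (+ 1)) :*ℤ conℤ (+ 1)) :*ℤ conℤ (+ 12))
                 refl (+ n))

open TwelfthConstant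

-- Write N = [n]_q, v_j = (q − 1) w_j,
-- which inverts [j]_q, and t_j = q^j v_j.
module ModuloCube (n-1 : ℕ) (n-1≥1 : 1 ≤ n-1) (φ P : Poly) (φP≋u : φ *ₚ P ≋ u (suc n-1))
                  (w : ℕ → Poly)
                  (w-inverse : ∀ j → 1 ≤ j → j < suc n-1 → Congruent oneₚ (φ ^ₚ 3) (u j *ₚ w j) oneₚ)
                  where

  n : ℕ
  n = suc n-1

  open Modulo oneₚ (φ ^ₚ 3) public

  N : Poly
  N = qint n

  y : Poly
  y = u 1 *ₚ N

  v : ℕ → Poly
  v j = u 1 *ₚ w j

  t : ℕ → Poly
  t j = X ^ₚ j *ₚ v j

  range-< : ∀ {j} → Range n-1 j → j < n
  range-< r = s≤s (proj₂ r)

  range-reflect : ∀ {j} → Range n-1 j → Range n-1 (n ∸ j)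
  range-reflect r = ℕP.m<n⇒0<n∸m (range-< r) , ℕP.∸-monoʳ-≤ n (proj₁ r)

  v-inverts-qint : ∀ {j} → Range n-1 j → (qint j *ₚ v j) ∼ oneₚ
  v-inverts-qint {j} r = ∼-trans
    (≋⇒∼ (≋-trans (solve 3 (λ q u w → q :* (u :* w) := (u :* q) :* w) ≋-refl (qint j) (u 1) (w j))
                  (*-congˡ (w j) (u1-qint j))))
    (w-inverse j (proj₁ r) (range-< r))

  u1-inverse : (u 1 *ₚ w 1) ∼ oneₚ
  u1-inverse = w-inverse 1 ℕP.≤-refl (s≤s n-1≥1)

  y≋φP : y ≋ φ *ₚ P
  y≋φP = ≋-trans (u1-qint n) (≋-sym φP≋u)

  cube-multiple-vanishes : ∀ T → Vanishes (φ *ₚ φ *ₚ φ *ₚ T)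
  cube-multiple-vanishes T = multiple T
    (solve 2 (λ φ t → con 1ℚ :* (φ :* φ :* φ :* t :- con 0ℚ) := t :* (φ :* (φ :* (φ :* con 1ℚ)))) ≋-refl φ T)

  -- N³ ≡ 0: up to the unit (q − 1)³, N³ is y³ = (φ P)³
  N³-vanishes : Vanishes (N *ₚ N *ₚ N)
  N³-vanishes = ∼-trans (≋⇒∼ (≋-trans unit-decomposition
                                       (+-cong (≋-trans (*-congʳ (w 1 *ₚ w 1 *ₚ w 1) (*-cong (*-cong y≋φP y≋φP) y≋φP))
                                                        (solve 3 (λ w φ p → w :* w :* w :* ((φ :* p) :* (φ :* p) :* (φ :* p))
                                                                            := φ :* φ :* φ :* (p :* p :* p :* w :* w :* w))
                                                                 ≋-refl (w 1) φ P))
                                               ≋-refl)))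
    (vanishes-+ (cube-multiple-vanishes (P *ₚ P *ₚ P *ₚ w 1 *ₚ w 1 *ₚ w 1))
                (vanishes-scaled u1-inverse (-ₚ (N *ₚ N *ₚ N *ₚ (a *ₚ a +ₚ a +ₚ oneₚ)))))
    where
    a = u 1 *ₚ w 1
    unit-decomposition : N *ₚ N *ₚ N ≋ w 1 *ₚ w 1 *ₚ w 1 *ₚ (y *ₚ y *ₚ y)
                                       +ₚ (-ₚ (N *ₚ N *ₚ N *ₚ (a *ₚ a +ₚ a +ₚ oneₚ))) *ₚ (a -ₚ oneₚ)
    unit-decomposition =
      solve 3 (λ N u W → N :* N :* N := W :* W :* W :* ((u :* N) :* (u :* N) :* (u :* N))
                                       :+ (:- (N :* N :* N :* ((u :* W) :* (u :* W) :+ u :* W :+ con 1ℚ))) :* (u :* W :- con 1ℚ))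
              ≋-refl N (u 1) (w 1)

  -- [n + j] / [j] ≡ 1 + t_j N, from [n + j] = [j] + q^j [n]
  ratio-expansion : ∀ {j} → Range n-1 j → (qint (n + j) *ₚ v j) ∼ (oneₚ +ₚ t j *ₚ N)
  ratio-expansion {j} r = ∼-trans (≋⇒∼ split) (+-cong∼ (v-inverts-qint r) ∼-refl)
    where
    split : qint (n + j) *ₚ v j ≋ qint j *ₚ v j +ₚ t j *ₚ N
    split = ≋-trans (*-congˡ (v j) (≋-trans (≡⇒≋ (cong qint (ℕP.+-comm n j))) (qint-+ j n)))
      (solve 4 (λ q x nn vv → (q :+ x :* nn) :* vv := q :* vv :+ (x :* vv) :* nn) ≋-refl (qint j) (X ^ₚ j) N (v j))

  -- second-order truncation of ∏ (1 + f_j N):  2 + 2 N s + N² (s² − p),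
  -- where s and p are the first and second power sums of the f_j
  second-order : (ℕ → Poly) → ℕ → Poly
  second-order f k = natₚ 2 +ₚ natₚ 2 *ₚ N *ₚ sumF f k
                     +ₚ N *ₚ N *ₚ (sumF f k *ₚ sumF f k -ₚ sumF (λ j → f j *ₚ f j) k)

  product-expansion : ∀ f k → (natₚ 2 *ₚ prodF (λ j → oneₚ +ₚ f j *ₚ N) k) ∼ second-order f k
  product-expansion f zero    = ≋⇒∼ (solve 1 (λ N → con (nat 2) :* con 1ℚ
    := con (nat 2) :+ con (nat 2) :* N :* con 0ℚ :+ N :* N :* (con 0ℚ :* con 0ℚ :- con 0ℚ)) ≋-refl N)
  product-expansion f (suc k) = by-combination
    (vanishes-+ (vanishes-scaled (product-expansion f k) (oneₚ +ₚ f (suc k) *ₚ N))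
                (vanishes-scaled N³-vanishes (f (suc k) *ₚ (s *ₚ s -ₚ p))))
    (solve 5 (λ P N s p t →
        con (nat 2) :* (P :* (con 1ℚ :+ t :* N))
          :- (con (nat 2) :+ con (nat 2) :* N :* (s :+ t) :+ N :* N :* ((s :+ t) :* (s :+ t) :- (p :+ t :* t)))
        := (con 1ℚ :+ t :* N) :* (con (nat 2) :* P :- (con (nat 2) :+ con (nat 2) :* N :* s :+ N :* N :* (s :* s :- p)))
           :+ t :* (s :* s :- p) :* (N :* N :* N :- con 0ℚ))
      ≋-refl (prodF (λ j → oneₚ +ₚ f j *ₚ N) k) N s p (f (suc k)))
    where
    s = sumF f k
    p = sumF (λ j → f j *ₚ f j) k

  A : Poly
  A = sumF (λ j → v j *ₚ v (n ∸ j)) n-1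

  -- S = Σ_j q^j v_j², i.e. Σ_j q^j / [j]²
  S : Poly
  S = sumF (λ j → X ^ₚ j *ₚ (v j *ₚ v j)) n-1

  -- t_j + t_{n−j} ≡ (q − 1) + N v_j v_{n−j}, from [n] = [n−j] + q^{n−j} [j]
  reflected-pair : ∀ {j} → Range n-1 j → (t j +ₚ t (n ∸ j)) ∼ (u 1 +ₚ N *ₚ (v j *ₚ v (n ∸ j)))
  reflected-pair {j} r = by-combination
    (vanishes-+ (vanishes-scaled (v-inverts-qint r) (u 1 -ₚ t a))
                (vanishes-scaled (v-inverts-qint (range-reflect r)) (-ₚ v j)))
    (≋-trans (+-cong (≋-refl {t j +ₚ t a}) (neg-cong (+-cong (≋-refl {u 1}) (*-congˡ (v j *ₚ v a) N-split))))
    (≋-trans (+-cong (+-cong (*-congˡ (v j) (X^-qint j)) (≋-refl {t a}))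
                     (≋-refl { -ₚ (u 1 +ₚ (qint a +ₚ X ^ₚ a *ₚ qint j) *ₚ (v j *ₚ v a))}))
    (solve 6 (λ u1 qj qa xa vj va → ((con 1ℚ :+ u1 :* qj) :* vj :+ xa :* va) :- (u1 :+ (qa :+ xa :* qj) :* (vj :* va))
               := (u1 :- xa :* va) :* (qj :* vj :- con 1ℚ) :+ (:- vj) :* (qa :* va :- con 1ℚ))
             ≋-refl (u 1) (qint j) (qint a) (X ^ₚ a) (v j) (v a))))
    where
    a = n ∸ j
    N-split : N ≋ qint a +ₚ X ^ₚ a *ₚ qint j
    N-split = ≋-trans (≡⇒≋ (cong qint (sym (ℕP.m∸n+n≡m (ℕP.<⇒≤ (range-< r)))))) (qint-+ a j)

  -- 2 Σ t_j ≡ (n − 1)(q − 1) + N A, pairing j with n − j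
  first-power-sum : (natₚ 2 *ₚ sumF t n-1) ∼ (natₚ n-1 *ₚ u 1 +ₚ N *ₚ A)
  first-power-sum = ∼-trans (≋⇒∼ pairing) (∼-trans (sumF-cong∼ n-1 (λ j → reflected-pair)) (≋⇒∼ collect))
    where
    pairing : natₚ 2 *ₚ sumF t n-1 ≋ sumF (λ j → t j +ₚ t (n ∸ j)) n-1
    pairing = ≋-trans (solve 1 (λ s → con (nat 2) :* s := s :+ s) ≋-refl (sumF t n-1))
      (≋-trans (+-cong (≋-refl {sumF t n-1}) (sumF-reverse t n-1)) (≋-sym (sumF-+ t (λ j → t (n ∸ j)) n-1)))
    collect : sumF (λ j → u 1 +ₚ N *ₚ (v j *ₚ v (n ∸ j))) n-1 ≋ natₚ n-1 *ₚ u 1 +ₚ N *ₚ A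
    collect = ≋-trans (sumF-+ (λ _ → u 1) (λ j → N *ₚ (v j *ₚ v (n ∸ j))) n-1)
      (+-cong (sumF-const (u 1) n-1) (sumF-scale N (λ j → v j *ₚ v (n ∸ j)) n-1))

  -- Σ t_j² ≡ S + (q − 1) Σ t_j, from q^j = 1 + (q − 1)[j]
  second-power-sum : sumF (λ j → t j *ₚ t j) n-1 ∼ (S +ₚ u 1 *ₚ sumF t n-1)
  second-power-sum = ∼-trans (sumF-cong∼ n-1 square)
    (≋⇒∼ (≋-trans (sumF-+ (λ j → X ^ₚ j *ₚ (v j *ₚ v j)) (λ j → u 1 *ₚ t j) n-1)
                  (+-cong (≋-refl {S}) (sumF-scale (u 1) t n-1))))
    where
    square : ∀ j → Range n-1 j → (t j *ₚ t j) ∼ (X ^ₚ j *ₚ (v j *ₚ v j) +ₚ u 1 *ₚ t j)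
    square j r = by-combination
      (vanishes-+ (vanishes-scaled (v-inverts-qint r) (X ^ₚ j *ₚ v j *ₚ u 1))
                  (vanishes-scaled (≋⇒∼ (X^-qint j)) (X ^ₚ j *ₚ v j *ₚ v j)))
      (solve 4 (λ x v u q → (x :* v) :* (x :* v) :- (x :* (v :* v) :+ u :* (x :* v))
                            := (x :* v :* u) :* (q :* v :- con 1ℚ) :+ (x :* v :* v) :* (x :- (con 1ℚ :+ u :* q)))
               ≋-refl (X ^ₚ j) (v j) (u 1) (qint j))

-- Computations "modulo φ" in the guise of congruences modulo φ³ weighted by
-- N²: since N³ ≡ 0 (mod φ³), N² (a − b) ≡ 0 as soon as a − b is a multiple
-- of N, and there every q^j is an n-th root of unity.
module ModuloFactor (n-1 : ℕ) (n-1≥1 : 1 ≤ n-1) (φ P : Poly) (φP≋u : φ *ₚ P ≋ u (suc n-1))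
                    (w : ℕ → Poly)
                    (w-inverse : ∀ j → 1 ≤ j → j < suc n-1 → Congruent oneₚ (φ ^ₚ 3) (u j *ₚ w j) oneₚ)
                    where

  open ModuloCube n-1 n-1≥1 φ P φP≋u w w-inverse public
  open Modulo (N *ₚ N) (φ ^ₚ 3) using () renaming
    (_∼_ to _∼'_; ∼-trans to ∼'-trans; ≋⇒∼ to ≋⇒∼'; +-cong∼ to +-cong∼'; *-congˡ∼ to *-congˡ∼';
     ^-cong∼ to ^-cong∼'; sumF-cong∼ to sumF-cong∼'; sumK-cong∼ to sumK-cong∼';
     vanishes-scaled to vanishes-scaled'; vanishes-+ to vanishes-+'; by-combination to by-combination')


  weight : ∀ {a b} → a ∼ b → a ∼' b
  weight {a} {b} (multiple h e) = multiple (N *ₚ N *ₚ h)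
    (≋-trans (≋-trans (*-congʳ (N *ₚ N) (≋-sym (*-identityˡ (a -ₚ b)))) (*-congʳ (N *ₚ N) e))
             (≋-sym (*-assoc (N *ₚ N) h (φ ^ₚ 3))))

  N∼'0 : N ∼' cst 0ℚ
  N∼'0 = multiple (quotient N³-vanishes)
    (≋-trans (solve 1 (λ N → N :* N :* (N :- con 0ℚ) := con 1ℚ :* (N :* N :* N :- con 0ℚ)) ≋-refl N)
             (divides N³-vanishes))

  qⁿ∼'1 : (X ^ₚ n) ∼' oneₚ
  qⁿ∼'1 = by-combination' (vanishes-+' (vanishes-scaled' N∼'0 (u 1)) (vanishes-scaled' (≋⇒∼' (u1-qint n)) (-ₚ oneₚ)))
    (solve 3 (λ x u N → x :- con 1ℚ := u :* (N :- con 0ℚ) :+ (:- con 1ℚ) :* (u :* N :- (x :- con 1ℚ)))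
             ≋-refl (X ^ₚ n) (u 1) N)

  root-of-unity : ∀ j → ((X ^ₚ j) ^ₚ n) ∼' oneₚ
  root-of-unity j = ∼'-trans (≋⇒∼' (X^-swap j n)) (∼'-trans (^-cong∼' j qⁿ∼'1) (≋⇒∼' (one-^ j)))

  u-inverse' : ∀ {j} → Range n-1 j → (u j *ₚ w j) ∼' oneₚ
  u-inverse' {j} r = weight (w-inverse j (proj₁ r) (range-< r))

  -- 1 + q^j + ⋯ + q^{j(n−1)} ≡ 0 for 0 < j < n, since q^j − 1 is invertible
  geom-root-vanishes : ∀ {j} → Range n-1 j → geom (X ^ₚ j) n ∼' cst 0ℚ
  geom-root-vanishes {j} r = by-combination'
    (vanishes-+' (vanishes-scaled' (u-inverse' r) (-ₚ G))
    (vanishes-+' (vanishes-scaled' (≋⇒∼' (geom-telescope (X ^ₚ j) n)) (w j))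
                 (vanishes-scaled' (root-of-unity j) (w j))))
    (solve 4 (λ G u W wn → G :- con 0ℚ := (:- G) :* (u :* W :- con 1ℚ) :+ (W :* (u :* G :- (wn :- con 1ℚ)) :+ W :* (wn :- con 1ℚ)))
             ≋-refl G (u j) (w j) ((X ^ₚ j) ^ₚ n))
    where G = geom (X ^ₚ j) n

  u-powerSum₁ : ∀ {j} → Range n-1 j → (u j *ₚ powerSum₁ (X ^ₚ j) n) ∼' natₚ n
  u-powerSum₁ {j} r = by-combination'
    (vanishes-+' (vanishes-scaled' (≋⇒∼' (powerSum₁-closed wj n)) oneₚ)
    (vanishes-+' (vanishes-scaled' (geom-root-vanishes r) (-ₚ oneₚ))
                 (vanishes-scaled' (root-of-unity j) (natₚ n -ₚ oneₚ))))
    (solve 5 (λ u y g wn k → u :* y :- k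
                := con 1ℚ :* ((u :* y :+ g :+ wn) :- (k :* wn :+ con 1ℚ))
                   :+ ((:- con 1ℚ) :* (g :- con 0ℚ) :+ (k :- con 1ℚ) :* (wn :- con 1ℚ)))
             ≋-refl (u j) (powerSum₁ wj n) (geom wj n) (wj ^ₚ n) (natₚ n))
    where wj = X ^ₚ j

  u-powerSum₂ : ∀ {j} → Range n-1 j →
                (u j *ₚ powerSum₂ (X ^ₚ j) n) ∼' (natₚ n *ₚ natₚ n -ₚ natₚ 2 *ₚ natₚ n -ₚ natₚ 2 *ₚ powerSum₁ (X ^ₚ j) n)
  u-powerSum₂ {j} r = by-combination'
    (vanishes-+' (vanishes-scaled' (≋⇒∼' (powerSum₂-closed wj n)) oneₚ)
    (vanishes-+' (vanishes-scaled' (root-of-unity j) ((natₚ n -ₚ oneₚ) *ₚ (natₚ n -ₚ oneₚ)))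
                 (vanishes-scaled' (geom-root-vanishes r) oneₚ)))
    (solve 6 (λ u y2 y1 g wn k → u :* y2 :- (k :* k :- con (nat 2) :* k :- con (nat 2) :* y1)
                := con 1ℚ :* ((u :* y2 :+ con (nat 2) :* y1 :+ con 1ℚ) :- ((k :- con 1ℚ) :* (k :- con 1ℚ) :* wn :+ g))
                   :+ ((k :- con 1ℚ) :* (k :- con 1ℚ) :* (wn :- con 1ℚ) :+ con 1ℚ :* (g :- con 0ℚ)))
             ≋-refl (u j) (powerSum₂ wj n) (powerSum₁ wj n) (geom wj n) (wj ^ₚ n) (natₚ n))
    where wj = X ^ₚ j

  -- H_j = (n − 2) Σ k q^{jk} − Σ k² q^{jk} satisfies (q^j − 1)² H_j ≡ 2n, so
  -- that 1/(q^j − 1)² is expressed through powers of q^j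
  H : ℕ → Poly
  H j = (natₚ n -ₚ natₚ 2) *ₚ powerSum₁ (X ^ₚ j) n -ₚ powerSum₂ (X ^ₚ j) n

  u²H : ∀ {j} → Range n-1 j → (u j *ₚ u j *ₚ H j) ∼' (natₚ 2 *ₚ natₚ n)
  u²H {j} r = by-combination'
    (vanishes-+' (vanishes-scaled' (u-powerSum₁ r) (u j *ₚ (natₚ n -ₚ natₚ 2) +ₚ natₚ 2))
                 (vanishes-scaled' (u-powerSum₂ r) (-ₚ u j)))
    (solve 4 (λ u y1 y2 k → u :* u :* ((k :- con (nat 2)) :* y1 :- y2) :- con (nat 2) :* k
                := (u :* (k :- con (nat 2)) :+ con (nat 2)) :* (u :* y1 :- k)
                   :+ (:- u) :* (u :* y2 :- (k :* k :- con (nat 2) :* k :- con (nat 2) :* y1)))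
             ≋-refl (u j) (powerSum₁ (X ^ₚ j) n) (powerSum₂ (X ^ₚ j) n) (natₚ n))

  inverse-square-term : ∀ {j} → Range n-1 j →
                        (natₚ 2 *ₚ natₚ n *ₚ (X ^ₚ j *ₚ (v j *ₚ v j))) ∼' (u 1 *ₚ u 1 *ₚ (X ^ₚ j *ₚ H j))
  inverse-square-term {j} r = by-combination'
    (vanishes-+' (vanishes-scaled' (u²H r) (-ₚ (u 1 *ₚ u 1 *ₚ X ^ₚ j *ₚ w j *ₚ w j)))
                 (vanishes-scaled' (u-inverse' r) (u 1 *ₚ u 1 *ₚ X ^ₚ j *ₚ H j *ₚ (u j *ₚ w j +ₚ oneₚ))))
    (solve 6 (λ u1 x w u h k → con (nat 2) :* k :* (x :* ((u1 :* w) :* (u1 :* w))) :- u1 :* u1 :* (x :* h)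
                := (:- (u1 :* u1 :* x :* w :* w)) :* (u :* u :* h :- con (nat 2) :* k)
                   :+ (u1 :* u1 :* x :* h :* (u :* w :+ con 1ℚ)) :* (u :* w :- con 1ℚ))
             ≋-refl (u 1) (X ^ₚ j) (w j) (u j) (H j) (natₚ n))

  G : ℕ → Poly
  G k = (natₚ n -ₚ natₚ 2) *ₚ natₚ k -ₚ natₚ k *ₚ natₚ k

  T : ℕ → Poly
  T m = sumF (λ j → (X ^ₚ j) ^ₚ m) n-1

  H-sum-swapped : sumF (λ j → X ^ₚ j *ₚ H j) n-1 ≋ sumK (λ k → G k *ₚ T (suc k)) n
  H-sum-swapped = ≋-trans (sumF-cong n-1 (λ j _ → powerSum-combination (X ^ₚ j) (natₚ n -ₚ natₚ 2) n))
    (≋-trans (sum-swap (λ j k → G k *ₚ (X ^ₚ j) ^ₚ suc k) n-1 n)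
             (sumK-cong n (λ k _ → sumF-scale (G k) (λ j → (X ^ₚ j) ^ₚ suc k) n-1)))

  T-proper : ∀ {m} → Range n-1 m → T m ∼' (-ₚ oneₚ)
  T-proper {m} r = by-combination'
    (vanishes-+' (vanishes-scaled' (geom-root-vanishes r) oneₚ) (vanishes-scaled' (≋⇒∼' geom-T) (-ₚ oneₚ)))
    (solve 2 (λ t g → t :- (:- con 1ℚ) := con 1ℚ :* (g :- con 0ℚ) :+ (:- con 1ℚ) :* (g :- (con 1ℚ :+ t)))
             ≋-refl (T m) (geom (X ^ₚ m) n))
    where
    geom-T : geom (X ^ₚ m) n ≋ oneₚ +ₚ T m
    geom-T = ≋-trans (geom-sumF (X ^ₚ m) n-1) (+-cong (≋-refl {oneₚ}) (sumF-cong n-1 (λ j _ → ≋-sym (X^-swap j m))))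

  T-full : T n ∼' natₚ n-1
  T-full = ∼'-trans (sumF-cong∼' n-1 (λ j _ → root-of-unity j))
                    (≋⇒∼' (≋-trans (sumF-const oneₚ n-1) (*-identityʳ (natₚ n-1))))

  V : Poly
  V = sumK (λ k → G k *ₚ (-ₚ oneₚ)) n-1 +ₚ G n-1 *ₚ natₚ n-1

  T-evaluated : sumK (λ k → G k *ₚ T (suc k)) n ∼' V
  T-evaluated = +-cong∼' (sumK-cong∼' n-1 (λ k k<n-1 → *-congˡ∼' (G k) (T-proper (s≤s z≤n , k<n-1))))
                         (*-congˡ∼' (G n-1) T-full)

  V-closed : natₚ 6 *ₚ V ≋ -ₚ (natₚ n *ₚ (natₚ n *ₚ natₚ n -ₚ oneₚ))
  V-closed = begin
    natₚ 6 *ₚ V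
      ≈⟨ *-distribˡ (natₚ 6) (sumK (λ k → G k *ₚ (-ₚ oneₚ)) n-1) (G n-1 *ₚ natₚ n-1) ⟩
    natₚ 6 *ₚ sumK (λ k → G k *ₚ (-ₚ oneₚ)) n-1 +ₚ natₚ 6 *ₚ (G n-1 *ₚ natₚ n-1)
      ≈⟨ +-cong (*-congʳ (natₚ 6) (≋-trans (sumK-cong n-1 (λ k _ → *-comm (G k) (-ₚ oneₚ)))
                                           (sumK-scale (-ₚ oneₚ) G n-1)))
                (≋-refl {natₚ 6 *ₚ (G n-1 *ₚ natₚ n-1)}) ⟩
    natₚ 6 *ₚ ((-ₚ oneₚ) *ₚ sumK G n-1) +ₚ natₚ 6 *ₚ (G n-1 *ₚ natₚ n-1)
      ≈⟨ +-cong (solve 2 (λ a b → a :* ((:- con 1ℚ) :* b) := (:- con 1ℚ) :* (a :* b)) ≋-refl (natₚ 6) (sumK G n-1))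
                (≋-refl {natₚ 6 *ₚ (G n-1 *ₚ natₚ n-1)}) ⟩
    (-ₚ oneₚ) *ₚ (natₚ 6 *ₚ sumK G n-1) +ₚ natₚ 6 *ₚ (G n-1 *ₚ natₚ n-1)
      ≈⟨ +-cong (*-congʳ (-ₚ oneₚ) (quadratic-sum (natₚ n -ₚ natₚ 2) n-1)) (≋-refl {natₚ 6 *ₚ (G n-1 *ₚ natₚ n-1)}) ⟩
    (-ₚ oneₚ) *ₚ (natₚ 3 *ₚ (natₚ n -ₚ natₚ 2) *ₚ natₚ n-1 *ₚ (natₚ n-1 -ₚ oneₚ)
                  -ₚ (natₚ n-1 -ₚ oneₚ) *ₚ natₚ n-1 *ₚ (natₚ 2 *ₚ natₚ n-1 -ₚ oneₚ))
      +ₚ natₚ 6 *ₚ (G n-1 *ₚ natₚ n-1)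
      ≈⟨ solve 1 (λ k → (:- con 1ℚ) :* (con (nat 3) :* ((con 1ℚ :+ k) :- con (nat 2)) :* k :* (k :- con 1ℚ)
                                         :- (k :- con 1ℚ) :* k :* (con (nat 2) :* k :- con 1ℚ))
                         :+ con (nat 6) :* ((((con 1ℚ :+ k) :- con (nat 2)) :* k :- k :* k) :* k)
                       := :- ((con 1ℚ :+ k) :* ((con 1ℚ :+ k) :* (con 1ℚ :+ k) :- con 1ℚ)))
               ≋-refl (natₚ n-1) ⟩
    -ₚ (natₚ n *ₚ (natₚ n *ₚ natₚ n -ₚ oneₚ)) ∎
    where open ≋-Reasoning

  inverse-square-sum' : (natₚ 12 *ₚ natₚ n *ₚ S) ∼' (-ₚ (u 1 *ₚ u 1 *ₚ natₚ n *ₚ (natₚ n *ₚ natₚ n -ₚ oneₚ)))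
  inverse-square-sum' = by-combination'
    (vanishes-+' (vanishes-scaled' S-as-H-sum (natₚ 6))
    (vanishes-+' (vanishes-scaled' (≋⇒∼' H-sum-swapped) (natₚ 6 *ₚ u 1 *ₚ u 1))
    (vanishes-+' (vanishes-scaled' T-evaluated (natₚ 6 *ₚ u 1 *ₚ u 1))
                 (vanishes-scaled' (≋⇒∼' V-closed) (u 1 *ₚ u 1)))))
    (solve 6 (λ k s u sf sk vv → con (nat 12) :* k :* s :- (:- (u :* u :* k :* (k :* k :- con 1ℚ)))
                := con (nat 6) :* (con (nat 2) :* k :* s :- u :* u :* sf)
                   :+ (con (nat 6) :* u :* u :* (sf :- sk)
                   :+ (con (nat 6) :* u :* u :* (sk :- vv)
                   :+ u :* u :* (con (nat 6) :* vv :- (:- (k :* (k :* k :- con 1ℚ)))))))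
             ≋-refl (natₚ n) S (u 1) (sumF (λ j → X ^ₚ j *ₚ H j) n-1) (sumK (λ k → G k *ₚ T (suc k)) n) V)
    where
    S-as-H-sum : (natₚ 2 *ₚ natₚ n *ₚ S) ∼' (u 1 *ₚ u 1 *ₚ sumF (λ j → X ^ₚ j *ₚ H j) n-1)
    S-as-H-sum = ∼'-trans (≋⇒∼' (≋-sym (sumF-scale (natₚ 2 *ₚ natₚ n) (λ j → X ^ₚ j *ₚ (v j *ₚ v j)) n-1)))
      (∼'-trans (sumF-cong∼' n-1 (λ j → inverse-square-term))
                (≋⇒∼' (sumF-scale (u 1 *ₚ u 1) (λ j → X ^ₚ j *ₚ H j) n-1)))

  -- A ≡ −S: v_{n−j} ≡ −q^j v_j because [n − j] ≡ −q^{−j}[j] when [n] ≡ 0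
  A∼'-S : A ∼' (-ₚ S)
  A∼'-S = ∼'-trans (sumF-cong∼' n-1 term)
    (≋⇒∼' (≋-trans (sumF-cong n-1 (λ j _ → solve 1 (λ a → :- a := (:- con 1ℚ) :* a) ≋-refl (X ^ₚ j *ₚ (v j *ₚ v j))))
          (≋-trans (sumF-scale (-ₚ oneₚ) (λ j → X ^ₚ j *ₚ (v j *ₚ v j)) n-1)
                   (solve 1 (λ s → (:- con 1ℚ) :* s := :- s) ≋-refl S))))
    where
    term : ∀ j → Range n-1 j → (v j *ₚ v (n ∸ j)) ∼' (-ₚ (X ^ₚ j *ₚ (v j *ₚ v j)))
    term j r = by-combination'
      (vanishes-+' (vanishes-scaled' N∼'0 (v j *ₚ v j *ₚ v a))
      (vanishes-+' (vanishes-scaled' (≋⇒∼' N-split) (-ₚ (v j *ₚ v j *ₚ v a)))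
      (vanishes-+' (vanishes-scaled' (weight (v-inverts-qint r)) (-ₚ (v j *ₚ v a)))
                   (vanishes-scaled' (weight (v-inverts-qint (range-reflect r))) (-ₚ (X ^ₚ j *ₚ v j *ₚ v j))))))
      (solve 6 (λ vj va x nn qj qa → vj :* va :- (:- (x :* (vj :* vj)))
                  := vj :* vj :* va :* (nn :- con 0ℚ)
                     :+ ((:- (vj :* vj :* va)) :* (nn :- (qj :+ x :* qa))
                     :+ ((:- (vj :* va)) :* (qj :* vj :- con 1ℚ) :+ (:- (x :* vj :* vj)) :* (qa :* va :- con 1ℚ))))
               ≋-refl (v j) (v a) (X ^ₚ j) N (qint j) (qint a))
      where
      a = n ∸ j
      N-split : N ≋ qint j +ₚ X ^ₚ j *ₚ qint a
      N-split = ≋-trans (≡⇒≋ (cong qint (sym (ℕP.m+[n∸m]≡n (ℕP.<⇒≤ (range-< r)))))) (qint-+ j a)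

module CentralBinomial (n-1 : ℕ) (n-1≥1 : 1 ≤ n-1) (φ P : Poly) (φP≋u : φ *ₚ P ≋ u (suc n-1))
                       (w : ℕ → Poly)
                       (w-inverse : ∀ j → 1 ≤ j → j < suc n-1 → Congruent oneₚ (φ ^ₚ 3) (u j *ₚ w j) oneₚ)
                       (B : Poly) (B-def : B *ₚ (qfact (suc n-1) *ₚ qfact (suc n-1)) ≈ₚ qfact (2 * suc n-1))
                       where

  open ModuloFactor n-1 n-1≥1 φ P φP≋u w w-inverse

  F : Poly
  F = qfact n-1

  Π : Poly
  Π = prodF (λ j → qint (n + j)) n-1

  -- B F² = (1 + qⁿ) Π F: multiply out [2n]! = Π [2n] [n]! with [2n] = (1 + qⁿ) N
  -- and [n]! = N F, then cancel N² (after multiplying by (q − 1)², as u_n²).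
  binomial-factorial : B *ₚ F *ₚ F ≋ (oneₚ +ₚ X ^ₚ n) *ₚ Π *ₚ F
  binomial-factorial = ≋-trans (solve 2 (λ a b → a := (a :- b) :+ b) ≋-refl (B *ₚ F *ₚ F) R)
                               (+-cong difference-vanishes (≋-refl {R}))
    where
    R = (oneₚ +ₚ X ^ₚ n) *ₚ Π *ₚ F
    E = B *ₚ F *ₚ F -ₚ R
    unfolded : B *ₚ (N *ₚ F *ₚ (N *ₚ F)) ≋ Π *ₚ (N +ₚ X ^ₚ n *ₚ N) *ₚ (N *ₚ F)
    unfolded = ≋-trans ⟨ B-def ⟩ (≋-trans (≡⇒≋ (cong qfact (cong (ℕ._+_ n) (ℕP.+-identityʳ n))))
                                 (≋-trans (qfact-+ n n) (*-congˡ (N *ₚ F) (*-congʳ Π (qint-+ n n)))))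
    u²E≋0 : u n *ₚ (u n *ₚ E) ≋ []
    u²E≋0 = begin
      u n *ₚ (u n *ₚ E)
        ≈⟨ *-cong (≋-sym (u1-qint n)) (*-congˡ E (≋-sym (u1-qint n))) ⟩
      y *ₚ (y *ₚ E)
        ≈⟨ solve 5 (λ u1 N b f e → (u1 :* N) :* ((u1 :* N) :* e) := u1 :* u1 :* (N :* N :* e)) ≋-refl (u 1) N B F E ⟩
      u 1 *ₚ u 1 *ₚ (N *ₚ N *ₚ E)
        ≈⟨ *-congʳ (u 1 *ₚ u 1) (solve 5 (λ N b f x p → N :* N :* (b :* f :* f :- (con 1ℚ :+ x) :* p :* f)
                                                         := b :* (N :* f :* (N :* f)) :- p :* (N :+ x :* N) :* (N :* f))
                                           ≋-refl N B F (X ^ₚ n) Π) ⟩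
      u 1 *ₚ u 1 *ₚ (B *ₚ (N *ₚ F *ₚ (N *ₚ F)) -ₚ Π *ₚ (N +ₚ X ^ₚ n *ₚ N) *ₚ (N *ₚ F))
        ≈⟨ *-congʳ (u 1 *ₚ u 1) (≋-trans (+-cong unfolded (≋-refl { -ₚ (Π *ₚ (N +ₚ X ^ₚ n *ₚ N) *ₚ (N *ₚ F))}))
                                         (+-inverseʳ (Π *ₚ (N +ₚ X ^ₚ n *ₚ N) *ₚ (N *ₚ F)))) ⟩
      u 1 *ₚ u 1 *ₚ []
        ≈⟨ *-zeroʳ (u 1 *ₚ u 1) ⟩
      [] ∎
      where open ≋-Reasoning
    difference-vanishes : E ≋ []
    difference-vanishes = u-cancel n (s≤s z≤n) E (u-cancel n (s≤s z≤n) (u n *ₚ E) u²E≋0)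

  factorial-inverse : (F *ₚ prodF v n-1) ∼ oneₚ
  factorial-inverse = ∼-trans (≋⇒∼ (≋-trans (*-congˡ (prodF v n-1) (qfact-prodF n-1)) (≋-sym (prodF-* qint v n-1))))
    (∼-trans (prodF-cong∼ n-1 (λ j → v-inverts-qint)) (≋⇒∼ (prodF-one n-1)))

  binomial-as-product : B ∼ ((oneₚ +ₚ X ^ₚ n) *ₚ prodF (λ j → qint (n + j) *ₚ v j) n-1)
  binomial-as-product = ∼-trans
    (by-combination (vanishes-+ (vanishes-scaled factorial-inverse (-ₚ (B *ₚ (F *ₚ F⁻¹ +ₚ oneₚ))))
                    (vanishes-+ (vanishes-scaled (≋⇒∼ binomial-factorial) (F⁻¹ *ₚ F⁻¹))
                                (vanishes-scaled factorial-inverse ((oneₚ +ₚ X ^ₚ n) *ₚ Π *ₚ F⁻¹))))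
      (solve 5 (λ b f i x p → b :- (con 1ℚ :+ x) :* p :* i
                  := (:- (b :* (f :* i :+ con 1ℚ))) :* (f :* i :- con 1ℚ)
                     :+ ((i :* i) :* (b :* f :* f :- (con 1ℚ :+ x) :* p :* f) :+ ((con 1ℚ :+ x) :* p :* i) :* (f :* i :- con 1ℚ)))
               ≋-refl B F F⁻¹ (X ^ₚ n) Π))
    (≋⇒∼ (≋-trans (*-assoc (oneₚ +ₚ X ^ₚ n) Π F⁻¹)
                  (*-congʳ (oneₚ +ₚ X ^ₚ n) (≋-sym (prodF-* (λ j → qint (n + j)) v n-1)))))
    where F⁻¹ = prodF v n-1

  binomial-expansion : (natₚ 2 *ₚ B) ∼ ((oneₚ +ₚ X ^ₚ n) *ₚ second-order t n-1)
  binomial-expansion = ∼-trans (*-congˡ∼ (natₚ 2) binomial-as-product)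
    (∼-trans (≋⇒∼ (solve 3 (λ k x p → k :* (x :* p) := x :* (k :* p)) ≋-refl
                           (natₚ 2) (oneₚ +ₚ X ^ₚ n) (prodF (λ j → qint (n + j) *ₚ v j) n-1)))
    (*-congˡ∼ (oneₚ +ₚ X ^ₚ n)
      (∼-trans (*-congˡ∼ (natₚ 2) (prodF-cong∼ n-1 (λ j → ratio-expansion))) (product-expansion t n-1))))

  c : ℚ
  c = (+ (n * n) ℤ.- + 1) / 12

  twelve-c : (cst c *ₚ natₚ 12) ∼ (natₚ n *ₚ natₚ n -ₚ oneₚ)
  twelve-c = ≋⇒∼ (≋-trans (cst-* c (nat 12))
    (≋-trans (≡⇒≋ (cong cst (twelfth n))) (+-cong (≋-sym (cst-* (nat n) (nat n))) (≋-refl { -ₚ oneₚ}))))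

  -- N² Σ q^j/[j]² ≡ −c y², dividing the result of ModuloFactor by 12 n
  inverse-square-sum : (N *ₚ N *ₚ S) ∼ (-ₚ (cst c *ₚ (y *ₚ y)))
  inverse-square-sum =
    cancel-invertible {natₚ 12} {cst (proj₁ (nat-invertible 11))} {N *ₚ N *ₚ S} { -ₚ (cst c *ₚ (y *ₚ y))}
                      (≋⇒∼ (proj₂ (nat-invertible 11)))
    (cancel-invertible {natₚ n} {cst (proj₁ (nat-invertible n-1))}
                       {natₚ 12 *ₚ (N *ₚ N *ₚ S)} {natₚ 12 *ₚ (-ₚ (cst c *ₚ (y *ₚ y)))}
                       (≋⇒∼ (proj₂ (nat-invertible n-1))) scaled)
    where
    scaled : (natₚ n *ₚ (natₚ 12 *ₚ (N *ₚ N *ₚ S))) ∼ (natₚ n *ₚ (natₚ 12 *ₚ (-ₚ (cst c *ₚ (y *ₚ y)))))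
    scaled = by-combination (vanishes-+ (vanishes-scaled (unweight inverse-square-sum') oneₚ)
                                        (vanishes-scaled twelve-c (natₚ n *ₚ u 1 *ₚ u 1 *ₚ N *ₚ N)))
      (solve 5 (λ m N S u c → m :* (con (nat 12) :* (N :* N :* S)) :- m :* (con (nat 12) :* (:- (c :* ((u :* N) :* (u :* N)))))
                  := con 1ℚ :* (N :* N :* (con (nat 12) :* m :* S) :- N :* N :* (:- (u :* u :* m :* (m :* m :- con 1ℚ))))
                     :+ (m :* u :* u :* N :* N) :* (c :* con (nat 12) :- (m :* m :- con 1ℚ)))
               ≋-refl (natₚ n) N S (u 1) (cst c))

  pair-product-sum : (N *ₚ N *ₚ A) ∼ (cst c *ₚ (y *ₚ y))
  pair-product-sum = by-combination
    (vanishes-+ (vanishes-scaled (unweight A∼'-S) oneₚ) (vanishes-scaled inverse-square-sum (-ₚ oneₚ)))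
    (solve 5 (λ N a s c y → N :* N :* a :- c :* (y :* y)
                := con 1ℚ :* (N :* N :* a :- N :* N :* (:- s)) :+ (:- con 1ℚ) :* (N :* N :* s :- (:- (c :* (y :* y)))))
             ≋-refl N A S (cst c) y)

  -- 4 (2 + 2 N s + N² (s² − p)) ≡ 8 + 4(n − 1) y + K y², K = 8c + (n − 1)² − 2(n − 1):
  -- 2 N s ≡ (n − 1) y + N² A, the N s² term keeps only ((n − 1) y)², and
  -- N² p ≡ N² S + (q − 1) N² s; all N³ terms vanish.
  K : Poly
  K = natₚ 8 *ₚ cst c +ₚ natₚ n-1 *ₚ natₚ n-1 -ₚ natₚ 2 *ₚ natₚ n-1

  Q₄ : Poly
  Q₄ = natₚ 8 +ₚ natₚ 4 *ₚ natₚ n-1 *ₚ y +ₚ K *ₚ y *ₚ y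

  second-order-value : (natₚ 4 *ₚ second-order t n-1) ∼ Q₄
  second-order-value = by-combination
    (vanishes-+ (vanishes-scaled (*-congˡ∼ N first-power-sum)
                                 (natₚ 4 +ₚ natₚ 2 *ₚ N *ₚ s +ₚ natₚ n-1 *ₚ y +ₚ N *ₚ N *ₚ A -ₚ natₚ 2 *ₚ y))
    (vanishes-+ (vanishes-scaled pair-product-sum (natₚ 4))
    (vanishes-+ (vanishes-scaled second-power-sum (-ₚ (natₚ 4 *ₚ N *ₚ N)))
    (vanishes-+ (vanishes-scaled inverse-square-sum (-ₚ natₚ 4))
                (vanishes-scaled N³-vanishes (natₚ 2 *ₚ natₚ n-1 *ₚ u 1 *ₚ A +ₚ N *ₚ A *ₚ A -ₚ natₚ 2 *ₚ u 1 *ₚ A))))))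
    (solve 8 (λ N s p a S u c k →
        con (nat 4) :* (con (nat 2) :+ con (nat 2) :* N :* s :+ N :* N :* (s :* s :- p))
          :- (con (nat 8) :+ con (nat 4) :* k :* (u :* N) :+ (con (nat 8) :* c :+ k :* k :- con (nat 2) :* k) :* (u :* N) :* (u :* N))
        := (con (nat 4) :+ con (nat 2) :* N :* s :+ k :* (u :* N) :+ N :* N :* a :- con (nat 2) :* (u :* N))
             :* (N :* (con (nat 2) :* s) :- N :* (k :* u :+ N :* a))
           :+ (con (nat 4) :* (N :* N :* a :- c :* ((u :* N) :* (u :* N)))
           :+ ((:- (con (nat 4) :* N :* N)) :* (p :- (S :+ u :* s))
           :+ ((:- con (nat 4)) :* (N :* N :* S :- (:- (c :* ((u :* N) :* (u :* N)))))
           :+ (con (nat 2) :* k :* u :* a :+ N :* a :* a :- con (nat 2) :* u :* a) :* (N :* N :* N :- con 0ℚ)))))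
      ≋-refl N s p A S (u 1) (cst c) (natₚ n-1))
    where
    s = sumF t n-1
    p = sumF (λ j → t j *ₚ t j) n-1

  -- 2 (1 + y)^m ≡ 2 + 2 m y + m (m − 1) y², as y³ ≡ 0
  binomial-theorem : ∀ m → (natₚ 2 *ₚ (oneₚ +ₚ y) ^ₚ m)
                           ∼ (natₚ 2 +ₚ natₚ 2 *ₚ natₚ m *ₚ y +ₚ natₚ m *ₚ (natₚ m -ₚ oneₚ) *ₚ y *ₚ y)
  binomial-theorem zero    = ≋⇒∼ (solve 1 (λ y → con (nat 2) :* con 1ℚ
    := con (nat 2) :+ con (nat 2) :* con 0ℚ :* y :+ con 0ℚ :* (con 0ℚ :- con 1ℚ) :* y :* y) ≋-refl y)
  binomial-theorem (suc m) = by-combination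
    (vanishes-+ (vanishes-scaled (binomial-theorem m) (oneₚ +ₚ y))
                (vanishes-scaled N³-vanishes (natₚ m *ₚ (natₚ m -ₚ oneₚ) *ₚ u 1 *ₚ u 1 *ₚ u 1)))
    (solve 4 (λ P u N k →
        con (nat 2) :* ((con 1ℚ :+ u :* N) :* P)
          :- (con (nat 2) :+ con (nat 2) :* (con 1ℚ :+ k) :* (u :* N) :+ (con 1ℚ :+ k) :* ((con 1ℚ :+ k) :- con 1ℚ) :* (u :* N) :* (u :* N))
        := (con 1ℚ :+ u :* N) :* (con (nat 2) :* P :- (con (nat 2) :+ con (nat 2) :* k :* (u :* N) :+ k :* (k :- con 1ℚ) :* (u :* N) :* (u :* N)))
           :+ k :* (k :- con 1ℚ) :* u :* u :* u :* (N :* N :* N :- con 0ℚ))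
      ≋-refl ((oneₚ +ₚ y) ^ₚ m) (u 1) N (natₚ m))

  qⁿ≋1+y : X ^ₚ n ≋ oneₚ +ₚ y
  qⁿ≋1+y = ≋-trans (solve 1 (λ x → x := con 1ℚ :+ (x :- con 1ℚ)) ≋-refl (X ^ₚ n)) (+-cong (≋-refl {oneₚ}) (≋-sym (u1-qint n)))

  R : Poly
  R = (oneₚ +ₚ X ^ₚ (n * n)) -ₚ c ·ₚ ((X ^ₚ n -ₚ oneₚ) ^ₚ 2)

  -- both 8B and 8R are ≡ 16 + 8 n y + (4 n (n − 1) − 8c) y²
  expansion : Poly
  expansion = natₚ 16 +ₚ natₚ 8 *ₚ natₚ n *ₚ y +ₚ (natₚ 4 *ₚ natₚ n *ₚ natₚ n-1 -ₚ natₚ 8 *ₚ cst c) *ₚ y *ₚ y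

  eight-B : (natₚ 8 *ₚ B) ∼ expansion
  eight-B = by-combination
    (vanishes-+ (vanishes-scaled binomial-expansion (natₚ 4))
    (vanishes-+ (vanishes-scaled second-order-value (oneₚ +ₚ X ^ₚ n))
    (vanishes-+ (vanishes-scaled (≋⇒∼ qⁿ≋1+y) Q₄)
    (vanishes-+ (vanishes-scaled twelve-c (natₚ 2 *ₚ y *ₚ y))
                (vanishes-scaled N³-vanishes (K *ₚ u 1 *ₚ u 1 *ₚ u 1))))))
    (solve 7 (λ b x q u N k c →
        con (nat 8) :* b
          :- (con (nat 16) :+ con (nat 8) :* (con 1ℚ :+ k) :* (u :* N)
              :+ (con (nat 4) :* (con 1ℚ :+ k) :* k :- con (nat 8) :* c) :* (u :* N) :* (u :* N))
        := con (nat 4) :* (con (nat 2) :* b :- (con 1ℚ :+ x) :* q)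
           :+ ((con 1ℚ :+ x) :* (con (nat 4) :* q :- Q₄-expr u N k c)
           :+ (Q₄-expr u N k c :* (x :- (con 1ℚ :+ u :* N))
           :+ (con (nat 2) :* (u :* N) :* (u :* N) :* (c :* con (nat 12) :- ((con 1ℚ :+ k) :* (con 1ℚ :+ k) :- con 1ℚ))
           :+ K-expr k c :* u :* u :* u :* (N :* N :* N :- con 0ℚ)))))
      ≋-refl B (X ^ₚ n) (second-order t n-1) (u 1) N (natₚ n-1) (cst c))
    where
    open PolynomialRing.Solver using (Polynomial)
    K-expr : ∀ {m} → Polynomial m → Polynomial m → Polynomial m
    K-expr k c = con (nat 8) :* c :+ k :* k :- con (nat 2) :* k
    Q₄-expr : ∀ {m} → Polynomial m → Polynomial m → Polynomial m → Polynomial m → Polynomial m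
    Q₄-expr u N k c = con (nat 8) :+ con (nat 4) :* k :* (u :* N) :+ K-expr k c :* (u :* N) :* (u :* N)

  eight-R : (natₚ 8 *ₚ R) ∼ expansion
  eight-R = by-combination
    (vanishes-+ (vanishes-scaled (≋⇒∼ q^n²≋) (natₚ 8))
    (vanishes-+ (vanishes-scaled (binomial-theorem n) (natₚ 4))
    (vanishes-+ (vanishes-scaled (≋⇒∼ scalar-as-product) (-ₚ natₚ 8))
                (vanishes-scaled (≋⇒∼ qⁿ≋1+y) (-ₚ (natₚ 8 *ₚ cst c *ₚ (X ^ₚ n -ₚ oneₚ +ₚ y)))))))
    (solve 8 (λ z pw cq x u N k c' →
        con (nat 8) :* ((con 1ℚ :+ z) :- cq)
          :- (con (nat 16) :+ con (nat 8) :* (con 1ℚ :+ k) :* (u :* N)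
              :+ (con (nat 4) :* (con 1ℚ :+ k) :* k :- con (nat 8) :* c') :* (u :* N) :* (u :* N))
        := con (nat 8) :* (z :- pw)
           :+ (con (nat 4) :* (con (nat 2) :* pw
                 :- (con (nat 2) :+ con (nat 2) :* (con 1ℚ :+ k) :* (u :* N) :+ (con 1ℚ :+ k) :* ((con 1ℚ :+ k) :- con 1ℚ) :* (u :* N) :* (u :* N)))
           :+ ((:- con (nat 8)) :* (cq :- c' :* ((x :- con 1ℚ) :* ((x :- con 1ℚ) :* con 1ℚ)))
           :+ (:- (con (nat 8) :* c' :* (x :- con 1ℚ :+ u :* N))) :* (x :- (con 1ℚ :+ u :* N)))))
      ≋-refl (X ^ₚ (n * n)) ((oneₚ +ₚ y) ^ₚ n) (c ·ₚ ((X ^ₚ n -ₚ oneₚ) ^ₚ 2)) (X ^ₚ n) (u 1) N (natₚ n-1) (cst c))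
    where
    q^n²≋ : X ^ₚ (n * n) ≋ (oneₚ +ₚ y) ^ₚ n
    q^n²≋ = ≋-trans (^-* X n n) (^-cong n qⁿ≋1+y)
    scalar-as-product : c ·ₚ ((X ^ₚ n -ₚ oneₚ) ^ₚ 2) ≋ cst c *ₚ ((X ^ₚ n -ₚ oneₚ) ^ₚ 2)
    scalar-as-product = ≋-sym (cst-*ₚ c ((X ^ₚ n -ₚ oneₚ) ^ₚ 2))

  central-binomial-congruence : B ∼ R
  central-binomial-congruence =
    cancel-invertible {natₚ 8} {cst (proj₁ (nat-invertible 7))} {B} {R}
                      (≋⇒∼ (proj₂ (nat-invertible 7))) (∼-trans eight-B (∼-sym eight-R))

-- A choice of inverses of q^j − 1 modulo Φ_n³, extended arbitrarily to all j.
module ChosenInverses (Φ : ℕ → Poly) (cyclotomic : IsCyclotomic Φ) (n : ℕ) (n≥1 : 1 ≤ n) where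
  open CoprimeToCyclotomic Φ cyclotomic n n≥1

  inverse : ℕ → Poly
  inverse j with 1 ≤? j | j <? n
  ... | yes j≥1 | yes j<n = proj₁ (u-invertible j j≥1 j<n)
  ... | _       | _       = cst 0ℚ

  inverse-correct : ∀ j → 1 ≤ j → j < n → Congruent oneₚ (Φ n ^ₚ 3) (u j *ₚ inverse j) oneₚ
  inverse-correct j j≥1 j<n with 1 ≤? j | j <? n
  ... | yes j≥1' | yes j<n' = proj₂ (u-invertible j j≥1' j<n')
  ... | no  j≱1  | _        = ⊥-elim (j≱1 j≥1)
  ... | yes _    | no  j≮n  = ⊥-elim (j≮n j<n)

binomial-2-1 : ∀ B → B *ₚ (qfact 1 *ₚ qfact 1) ≈ₚ qfact (2 * 1) →
               B ≋ (oneₚ +ₚ X ^ₚ (1 * 1)) -ₚ ((+ (1 * 1) ℤ.- + 1) / 12) ·ₚ ((X ^ₚ 1 -ₚ oneₚ) ^ₚ 2)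
binomial-2-1 B B-def = begin
  B                          ≈⟨ *-identityʳ B ⟨
  B *ₚ oneₚ                  ≈⟨ *-congʳ B [1]!² ⟨
  B *ₚ (qfact 1 *ₚ qfact 1)  ≈⟨ ⟨ B-def ⟩ ⟩
  qfact 2                    ≈⟨ [2]! ⟩
  oneₚ +ₚ X                  ≈⟨ right-side ⟨
  (oneₚ +ₚ X ^ₚ (1 * 1)) -ₚ ((+ (1 * 1) ℤ.- + 1) / 12) ·ₚ ((X ^ₚ 1 -ₚ oneₚ) ^ₚ 2) ∎
  where
  open ≋-Reasoning
  [1]!² : qfact 1 *ₚ qfact 1 ≋ oneₚ
  [1]!² = ⟨ (λ { 0 → refl ; 1 → refl ; 2 → refl ; 3 → refl ; (suc (suc (suc (suc i)))) → refl }) ⟩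
  [2]! : qfact 2 ≋ oneₚ +ₚ X
  [2]! = ⟨ (λ { 0 → refl ; 1 → refl ; 2 → refl ; 3 → refl ; (suc (suc (suc (suc i)))) → refl }) ⟩
  right-side : (oneₚ +ₚ X ^ₚ (1 * 1)) -ₚ ((+ (1 * 1) ℤ.- + 1) / 12) ·ₚ ((X ^ₚ 1 -ₚ oneₚ) ^ₚ 2) ≋ oneₚ +ₚ X
  right-side = ⟨ (λ { 0 → refl ; 1 → refl ; 2 → refl ; 3 → refl ; (suc (suc (suc (suc i)))) → refl }) ⟩

central-binomial : (Φ : ℕ → Poly) → IsCyclotomic Φ → (n : ℕ) → 1 ≤ n → (B : Poly) →
                   B *ₚ (qfact n *ₚ qfact n) ≈ₚ qfact (2 * n) →
                   Congruent oneₚ (Φ n ^ₚ 3) B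
                     ((oneₚ +ₚ X ^ₚ (n * n)) -ₚ ((+ (n * n) ℤ.- + 1) / 12) ·ₚ ((X ^ₚ n -ₚ oneₚ) ^ₚ 2))
central-binomial Φ cyclotomic (suc zero)      _   B B-def = Modulo.≋⇒∼ oneₚ (Φ 1 ^ₚ 3) (binomial-2-1 B B-def)
central-binomial Φ cyclotomic (suc (suc n-2)) n≥1 B B-def = central-binomial-congruence
  where
  open CoprimeToCyclotomic Φ cyclotomic (suc (suc n-2)) n≥1 using (P; Φ-divides-u)
  open ChosenInverses Φ cyclotomic (suc (suc n-2)) n≥1
  open CentralBinomial (suc n-2) (s≤s z≤n) (Φ (suc (suc n-2))) P Φ-divides-u inverse inverse-correct B B-def

-- binom(2n, n)_q ≡ [2]_{q^{n²}} − (n² − 1)/12 · (qⁿ − 1)²  (mod Φ_n(q)³); the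
-- congruence holds already in ℚ[q].
lemma13 : (Φ : ℕ → Poly) → IsCyclotomic Φ → (n : ℕ) → 1 ≤ n → (B : Poly) → B *ₚ (qfact n *ₚ qfact n) ≈ₚ qfact (2 * n) → B ≡ (oneₚ +ₚ X ^ₚ (n * n)) -ₚ ((+ (n * n) Data.Integer.- + 1) / 12) ·ₚ ((X ^ₚ n -ₚ oneₚ) ^ₚ 2) [modₚ Φ n ^ₚ 3 ]
lemma13 Φ cyclotomic n n≥1 B B-def = 0 , quotient congruence , un (divides congruence)
  where
  congruence = central-binomial Φ cyclotomic n n≥1 B B-def
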